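{- Let $0 \le j \le i \le n/2$ and let $V_j$ be the $j$-th eigenspace of the Hamming sphere $S(n,i)$. Then for each $y \in \{0,1\}^n$ with $|y| = j$, there is, up to a multiplicative scalar, a unique non-zero function $F_{y,j} \in V_j$ which is semi-symmetric around $y$ (i.e. the space of functions in $V_j$ that are semi-symmetric around $y$ is one-dimensional). Furthermore, the functions $\{F_{y,j}\}_{y \in S(n,j)}$ span $V_j$.
   Context: Points of $\{0,1\}^n$ are identified with subsets of $\{1,\dots,n\}$; $|x|$ is the Hamming weight and $|x-y|$ the Hamming distance. $S(n,i)=\{x\in\{0,1\}^n : |x|=i\}$. Functions on $S(n,i)$ are real-valued, with the standard inner product $\langle f,g\rangle=\sum_{x\in S(n,i)}f(x)g(x)$ (up to normalization). For $z\in\{0,1\}^n$ with $|z|\le i$, let $g_z$ be the function on $S(n,i)$ with $g_z(x)=1$ if $z\subseteq x$ and $0$ otherwise. For $0\le j\le i$ let $U_j=\mathrm{span}\{g_z : |z|\le j\}$. The eigenspaces of $S(n,i)$ are $V_0=U_0$ (the constant functions) and $V_j=U_j\cap U_{j-1}^{\perp}$ for $1\le j\le i$. A function $f$ on $S(n,i)$ is semi-symmetric around $y\in\{0,1\}^n$ if $f(x)$ depends only on $|x-y|$.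
   Formalization: Functions on S(n,i) take values in ℚ rather than ℝ, so the eigenspaces V_j, the semi-symmetric functions, the scalars and the spanning combinations are all taken over the rationals. -}

module Defs where

open import Data.Bool using (Bool; true; false; _∧_; _∨_; not; _xor_; if_then_else_)
open import Data.Nat using (ℕ; zero; suc; _≤_; _<_; _≟_)
open import Data.Vec using (Vec; []; _∷_; zipWith; foldr)
open import Data.List using (List; []; _∷_; _++_; map)
open import Data.Product using (Σ; _×_; _,_; ∃; proj₁; proj₂)
open import Data.List.Relation.Unary.All using (All)
open import Data.Rational using (ℚ; 0ℚ; 1ℚ; _+_; _*_)
open import Relation.Nullary using (Dec; yes; no; ¬_)
open import Relation.Binary.PropositionalEquality using (_≡_)

-- Points of {0,1}^n, identified with subsets of {1..n}
Point : ℕ → Set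
Point n = Vec Bool n

weight : ∀ {n} → Point n → ℕ
weight [] = 0
weight (true ∷ xs) = suc (weight xs)
weight (false ∷ xs) = weight xs

dist : ∀ {n} → Point n → Point n → ℕ
dist x y = weight (zipWith _xor_ x y)

subsetᵇ : ∀ {n} → Point n → Point n → Bool
subsetᵇ z x = foldr (λ _ → Bool) _∧_ true (zipWith (λ a b → not a ∨ b) z x)

S : ℕ → ℕ → Set
S n i = Σ (Point n) (λ x → weight x ≡ i)

-- Real-valued functions on S(n,i) (scalars taken in ℚ)
Fun : ℕ → ℕ → Set
Fun n i = S n i → ℚ

allPoints : (n : ℕ) → List (Point n)
allPoints zero = [] ∷ []
allPoints (suc n) = map (true ∷_) (allPoints n) ++ map (false ∷_) (allPoints n)

sumℚ : List ℚ → ℚ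
sumℚ [] = 0ℚ
sumℚ (q ∷ qs) = q + sumℚ qs

term : ∀ {n i} → Fun n i → Fun n i → (x : Point n) → Dec (weight x ≡ i) → ℚ
term f g x (yes p) = f (x , p) * g (x , p)
term f g x (no _) = 0ℚ

⟪_,_⟫ : ∀ {n i} → Fun n i → Fun n i → ℚ
⟪_,_⟫ {n} {i} f g = sumℚ (map (λ x → term f g x (weight x ≟ i)) (allPoints n))

gz : ∀ {n i} → Point n → Fun n i
gz z (x , _) = if subsetᵇ z x then 1ℚ else 0ℚ

InSpan : ∀ {n i} {A : Set} → (A → Set) → (A → Fun n i) → Fun n i → Set
InSpan {n} {i} {A} P gen f =
  Σ (List (A × ℚ)) λ cs →
    All (λ p → P (proj₁ p)) cs ×
    (∀ (x : S n i) → f x ≡ sumℚ (map (λ p → proj₂ p * gen (proj₁ p) x) cs))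

U : ∀ {n i} → ℕ → Fun n i → Set
U {n} {i} j f = InSpan {n} {i} {Point n} (λ z → weight z ≤ j) gz f

V : ∀ {n i} → ℕ → Fun n i → Set
V {n} {i} zero f = U {n} {i} 0 f
V {n} {i} (suc j) f = U {n} {i} (suc j) f × (∀ h → U {n} {i} j h → ⟪ f , h ⟫ ≡ 0ℚ)

SemiSymmetric : ∀ {n i} → Point n → Fun n i → Set
SemiSymmetric {n} {i} y f =
  ∀ (x x′ : S n i) → dist (proj₁ x) y ≡ dist (proj₁ x′) y → f x ≡ f x′

NonZero : ∀ {n i} → Fun n i → Set
NonZero {n} {i} f = Σ (S n i) λ x → ¬ (f x ≡ 0ℚ)

-- Fix y with |y| = j and write m(x) = |x ∩ y|.  On S(n,i), where i + j ≤ n, a function is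
-- semi-symmetric around y iff it is a function φ of m(x).  Newton's forward-difference formula
-- φ(m) = ∑_k C(m,k) Δᵏφ(0), together with C(m(x),k) = ∑_{v ⊆ y, |v| = k} g_v(x), shows that such a
-- function equals D·g_y modulo U_{j-1}, where D = Δʲφ(0); in particular it lies in U_j.
--
-- Uniqueness: if H is semi-symmetric, orthogonal to U_{j-1} and vanishes at a point containing y,
-- then H(x) = 0 by downward induction on m(x): once H vanishes at larger overlaps, ⟪H, g_{x∩y}⟫ = 0
-- is H(x) times the positive number of points x′ ⊇ x ∩ y with m(x′) = m(x).
--
-- Existence: F(x) = (−1)^|x∩y| · |x∖y|! · |∁(x∪y)|! is orthogonal to every g_w with |w| < j.  Sort
-- the points x ⊇ w by the numbers c and d of points they take from y∖w and from ∁(w∪y).  The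
-- constraint |x| = i fixes d, and the sum over d collapses to (−1)^c times a polynomial of degree
-- |w∖y| in c, whose alternating binomial sum over c vanishes because |w∖y| < |y∖w|.
--
-- Spanning: F_y ≡ D·g_y modulo U_{j-1} with D ≠ 0 (else F_y ∈ U_{j-1} ∩ U_{j-1}^⊥ = 0), hence
-- U_j ⊆ span{F_y} + U_{j-1}, and for f ∈ V_j the difference between f and its part in span{F_y}
-- lies in U_{j-1} ∩ U_{j-1}^⊥ = 0.

module Submission where

open import Defs
open import Data.Nat using (ℕ; _≤_; _*_)
open import Data.Product using (Σ; _×_; _,_)
open import Data.Rational using (ℚ) renaming (_*_ to _*ℚ_)
open import Relation.Binary.PropositionalEquality using (_≡_)

open import Data.Bool using (Bool; true; false; if_then_else_)
open import Data.Empty using (⊥-elim)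
open import Data.Fin.Subset using (_∩_; _∪_; _─_; ∁)
open import Data.Fin.Subset.Properties using (∩-comm)
open import Data.List using (List; []; _∷_; _++_; map)
open import Data.List.Membership.Propositional using (_∈_)
open import Data.List.Membership.Propositional.Properties using (∈-map⁺; ∈-++⁺ˡ; ∈-++⁺ʳ)
open import Data.List.Relation.Unary.All as All using (All; []; _∷_)
open import Data.List.Relation.Unary.All.Properties using (++⁺; map⁺)
open import Data.List.Relation.Unary.Any using (here; there)
open import Data.Nat as ℕ using (zero; suc; z≤n; s≤s; _<_; _≟_; _∸_) renaming (_+_ to _+ₙ_)
import Data.Nat.Properties as ℕₚ
open import Algebra.Properties.CommutativeSemigroup ℕₚ.+-commutativeSemigroup using (interchange)
open import Data.Product using (proj₁; proj₂)
open import Data.Rational using (0ℚ; 1ℚ; _+_; _-_; -_; 1/_) renaming (_*_ to _·_; _≤_ to _≤ℚ_; _<_ to _<ℚ_)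
import Data.Rational as ℚ
import Data.Rational.Properties as ℚₚ
open import Data.Rational.Solver using (module +-*-Solver)
open import Data.Sum using (inj₁; inj₂)
open import Data.Vec using ([]; _∷_)
open import Relation.Binary.PropositionalEquality
  using (_≢_; _≗_; refl; sym; trans; cong; cong₂; subst; subst₂; module ≡-Reasoning)
open import Relation.Nullary using (Dec; yes; no; does)
open import Relation.Nullary.Decidable using (dec-true; dec-false)

open +-*-Solver using (solve; _:+_; _:-_; :-_; _:*_; _:=_; con)

χ : Bool → ℚ
χ b = if b then 1ℚ else 0ℚ

δ : ℕ → ℕ → ℚ
δ a b = χ (does (a ≟ b))

χ-nonneg : ∀ b → 0ℚ ≤ℚ χ b
χ-nonneg true = ℚₚ.nonNegative⁻¹ 1ℚ
χ-nonneg false = ℚₚ.≤-refl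

δ-nonneg : ∀ a b → 0ℚ ≤ℚ δ a b
δ-nonneg a b = χ-nonneg (does (a ≟ b))

δ-≡ : ∀ {a b} → a ≡ b → δ a b ≡ 1ℚ
δ-≡ {a} {b} a≡b = cong χ (dec-true (a ≟ b) a≡b)

δ-≢ : ∀ {a b} → a ≢ b → δ a b ≡ 0ℚ
δ-≢ {a} {b} a≢b = cong χ (dec-false (a ≟ b) a≢b)

δ-≢-· : ∀ {a b} → a ≢ b → ∀ x → δ a b · x ≡ 0ℚ
δ-≢-· a≢b x = trans (cong (_· x) (δ-≢ a≢b)) (ℚₚ.*-zeroˡ x)

δ-subst : ∀ a b (f : ℕ → ℚ) → δ a b · f a ≡ δ a b · f b
δ-subst a b f with a ≟ b
... | yes refl = refl
... | no a≢b = trans (δ-≢-· a≢b (f a)) (sym (δ-≢-· a≢b (f b)))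

δ-cong : ∀ {a b c d} → (a ≡ b → c ≡ d) → (c ≡ d → a ≡ b) → δ a b ≡ δ c d
δ-cong {a} {b} to from with a ≟ b
... | yes a≡b = trans (δ-≡ a≡b) (sym (δ-≡ (to a≡b)))
... | no a≢b = trans (δ-≢ a≢b) (sym (δ-≢ (λ c≡d → a≢b (from c≡d))))

y≢0⇒x·y≡0⇒x≡0 : ∀ x y → y ≢ 0ℚ → x · y ≡ 0ℚ → x ≡ 0ℚ
y≢0⇒x·y≡0⇒x≡0 x y y≢0 xy≡0 = begin
  x                     ≡⟨ sym (ℚₚ.*-identityʳ x) ⟩
  x · 1ℚ                ≡⟨ cong (x ·_) (sym (ℚₚ.*-inverseʳ y)) ⟩
  x · (y · 1/ y)        ≡⟨ sym (ℚₚ.*-assoc x y (1/ y)) ⟩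
  x · y · 1/ y          ≡⟨ cong (_· 1/ y) xy≡0 ⟩
  0ℚ · 1/ y             ≡⟨ ℚₚ.*-zeroˡ (1/ y) ⟩
  0ℚ                    ∎
  where
  open ≡-Reasoning
  instance
    y-nonZero : ℚ.NonZero y
    y-nonZero = ℚ.≢-nonZero y≢0

·-nonzero : ∀ {x y} → x ≢ 0ℚ → y ≢ 0ℚ → x · y ≢ 0ℚ
·-nonzero {x} {y} x≢0 y≢0 xy≡0 = x≢0 (y≢0⇒x·y≡0⇒x≡0 x y y≢0 xy≡0)

x-y≡0⇒x≡y : ∀ {x y} → x - y ≡ 0ℚ → x ≡ y
x-y≡0⇒x≡y {x} {y} x-y≡0 = begin
  x              ≡⟨ solve 2 (λ x y → x := (x :- y) :+ y) refl x y ⟩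
  (x - y) + y    ≡⟨ cong (_+ y) x-y≡0 ⟩
  0ℚ + y         ≡⟨ ℚₚ.+-identityˡ y ⟩
  y              ∎
  where open ≡-Reasoning

0<⇒≢0 : ∀ {x} → 0ℚ <ℚ x → x ≢ 0ℚ
0<⇒≢0 0<x x≡0 = ℚₚ.<-irrefl (sym x≡0) 0<x

·-nonneg : ∀ {x y} → 0ℚ ≤ℚ x → 0ℚ ≤ℚ y → 0ℚ ≤ℚ x · y
·-nonneg {x} {y} 0≤x 0≤y = ℚₚ.nonNegative⁻¹ (x · y)
  {{ℚₚ.nonNeg*nonNeg⇒nonNeg x {{ℚ.nonNegative 0≤x}} y {{ℚ.nonNegative 0≤y}}}}

·-pos : ∀ {x y} → 0ℚ <ℚ x → 0ℚ <ℚ y → 0ℚ <ℚ x · y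
·-pos {x} {y} 0<x 0<y = ℚₚ.positive⁻¹ (x · y)
  {{ℚₚ.pos*pos⇒pos x {{ℚ.positive 0<x}} y {{ℚ.positive 0<y}}}}

x·x-nonneg : ∀ x → 0ℚ ≤ℚ x · x
x·x-nonneg x with ℚₚ.≤-total x 0ℚ
... | inj₁ x≤0 = ℚₚ.nonNegative⁻¹ (x · x)
  {{ℚₚ.nonPos*nonPos⇒nonPos x {{ℚ.nonPositive x≤0}} x {{ℚ.nonPositive x≤0}}}}
... | inj₂ 0≤x = ·-nonneg 0≤x 0≤x

x·x≡0⇒x≡0 : ∀ x → x · x ≡ 0ℚ → x ≡ 0ℚ
x·x≡0⇒x≡0 x xx≡0 with x ℚₚ.≟ 0ℚ
... | yes x≡0 = x≡0
... | no x≢0 = y≢0⇒x·y≡0⇒x≡0 x x x≢0 xx≡0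

x+y≡0⇒x≡0 : ∀ {x y} → 0ℚ ≤ℚ x → 0ℚ ≤ℚ y → x + y ≡ 0ℚ → x ≡ 0ℚ
x+y≡0⇒x≡0 {x} {y} 0≤x 0≤y x+y≡0 = ℚₚ.≤-antisym x≤0 0≤x
  where
  x≤0 : x ≤ℚ 0ℚ
  x≤0 = subst₂ _≤ℚ_ (ℚₚ.+-identityʳ x) x+y≡0 (ℚₚ.+-monoʳ-≤ x 0≤y)

∑ : {A : Set} → List A → (A → ℚ) → ℚ
∑ xs f = sumℚ (map f xs)

module _ {A : Set} where

  ∑-++ : (xs ys : List A) (f : A → ℚ) → ∑ (xs ++ ys) f ≡ ∑ xs f + ∑ ys f
  ∑-++ [] ys f = sym (ℚₚ.+-identityˡ (∑ ys f))
  ∑-++ (x ∷ xs) ys f = trans (cong (f x +_) (∑-++ xs ys f)) (sym (ℚₚ.+-assoc (f x) _ _))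

  ∑-map : {B : Set} (g : A → B) (xs : List A) (f : B → ℚ) → ∑ (map g xs) f ≡ ∑ xs (λ a → f (g a))
  ∑-map g [] f = refl
  ∑-map g (x ∷ xs) f = cong (f (g x) +_) (∑-map g xs f)

  ∑-cong : (xs : List A) {f g : A → ℚ} → (∀ a → f a ≡ g a) → ∑ xs f ≡ ∑ xs g
  ∑-cong [] f≗g = refl
  ∑-cong (x ∷ xs) f≗g = cong₂ _+_ (f≗g x) (∑-cong xs f≗g)

  ∑-zero : (xs : List A) {f : A → ℚ} → (∀ a → f a ≡ 0ℚ) → ∑ xs f ≡ 0ℚ
  ∑-zero [] f≗0 = refl
  ∑-zero (x ∷ xs) f≗0 = cong₂ _+_ (f≗0 x) (∑-zero xs f≗0)

  ∑-+ : (xs : List A) (f g : A → ℚ) → ∑ xs (λ a → f a + g a) ≡ ∑ xs f + ∑ xs g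
  ∑-+ [] f g = refl
  ∑-+ (x ∷ xs) f g = trans (cong (f x + g x +_) (∑-+ xs f g))
    (solve 4 (λ a b c d → (a :+ b) :+ (c :+ d) := (a :+ c) :+ (b :+ d)) refl (f x) (g x) (∑ xs f) (∑ xs g))

  ∑-· : (xs : List A) (c : ℚ) (f : A → ℚ) → ∑ xs (λ a → c · f a) ≡ c · ∑ xs f
  ∑-· [] c f = sym (ℚₚ.*-zeroʳ c)
  ∑-· (x ∷ xs) c f = trans (cong (c · f x +_) (∑-· xs c f)) (sym (ℚₚ.*-distribˡ-+ c (f x) _))

  ∑-nonneg : (xs : List A) {f : A → ℚ} → (∀ a → 0ℚ ≤ℚ f a) → 0ℚ ≤ℚ ∑ xs f
  ∑-nonneg [] f≥0 = ℚₚ.≤-refl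
  ∑-nonneg (x ∷ xs) f≥0 = ℚₚ.+-mono-≤ (f≥0 x) (∑-nonneg xs f≥0)

  ∑-nonneg≡0⇒≡0 : {xs : List A} {f : A → ℚ} → (∀ a → 0ℚ ≤ℚ f a) → ∑ xs f ≡ 0ℚ →
                   ∀ {a} → a ∈ xs → f a ≡ 0ℚ
  ∑-nonneg≡0⇒≡0 {x ∷ xs} f≥0 ∑≡0 (here refl) = x+y≡0⇒x≡0 (f≥0 x) (∑-nonneg xs f≥0) ∑≡0
  ∑-nonneg≡0⇒≡0 {x ∷ xs} {f} f≥0 ∑≡0 (there a∈xs) =
    ∑-nonneg≡0⇒≡0 f≥0 (x+y≡0⇒x≡0 (∑-nonneg xs f≥0) (f≥0 x) (trans (ℚₚ.+-comm _ (f x)) ∑≡0))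
                  a∈xs

∑-allPoints-suc : ∀ n (f : Point (suc n) → ℚ) →
  ∑ (allPoints (suc n)) f ≡ ∑ (allPoints n) (λ x → f (true ∷ x)) + ∑ (allPoints n) (λ x → f (false ∷ x))
∑-allPoints-suc n f = trans (∑-++ (map (true ∷_) (allPoints n)) _ f)
  (cong₂ _+_ (∑-map (true ∷_) (allPoints n) f) (∑-map (false ∷_) (allPoints n) f))

∈-allPoints : ∀ {n} (x : Point n) → x ∈ allPoints n
∈-allPoints [] = here refl
∈-allPoints {suc n} (true ∷ x) = ∈-++⁺ˡ (∈-map⁺ (true ∷_) (∈-allPoints x))
∈-allPoints {suc n} (false ∷ x) = ∈-++⁺ʳ (map (true ∷_) (allPoints n)) (∈-map⁺ (false ∷_) (∈-allPoints x))

module _ {n i : ℕ} where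

  infixl 6 _+ᶠ_ _-ᶠ_
  infixl 7 _·ᶠ_

  0ᶠ : Fun n i
  0ᶠ _ = 0ℚ

  _+ᶠ_ _-ᶠ_ : Fun n i → Fun n i → Fun n i
  (f +ᶠ g) x = f x + g x
  (f -ᶠ g) x = f x - g x

  _·ᶠ_ : ℚ → Fun n i → Fun n i
  (c ·ᶠ f) x = c · f x

  ⟪⟫-comm : (f g : Fun n i) → ⟪ f , g ⟫ ≡ ⟪ g , f ⟫
  ⟪⟫-comm f g = ∑-cong (allPoints n) (λ x → comm x (weight x ≟ i))
    where
    comm : ∀ x d → term f g x d ≡ term g f x d
    comm x (yes p) = ℚₚ.*-comm (f (x , p)) (g (x , p))
    comm x (no _) = refl

  ⟪⟫-congˡ : ∀ {f f′} g → f ≗ f′ → ⟪ f , g ⟫ ≡ ⟪ f′ , g ⟫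
  ⟪⟫-congˡ {f} {f′} g f≗f′ = ∑-cong (allPoints n) (λ x → congˡ x (weight x ≟ i))
    where
    congˡ : ∀ x d → term f g x d ≡ term f′ g x d
    congˡ x (yes p) = cong (_· g (x , p)) (f≗f′ (x , p))
    congˡ x (no _) = refl

  ⟪⟫-zeroˡ : ∀ g → ⟪ 0ᶠ , g ⟫ ≡ 0ℚ
  ⟪⟫-zeroˡ g = ∑-zero (allPoints n) (λ x → vanish x (weight x ≟ i))
    where
    vanish : ∀ x d → term 0ᶠ g x d ≡ 0ℚ
    vanish x (yes p) = ℚₚ.*-zeroˡ (g (x , p))
    vanish x (no _) = refl

  ⟪⟫-+ˡ : ∀ f f′ g → ⟪ f +ᶠ f′ , g ⟫ ≡ ⟪ f , g ⟫ + ⟪ f′ , g ⟫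
  ⟪⟫-+ˡ f f′ g = trans (∑-cong (allPoints n) (λ x → distrib x (weight x ≟ i))) (∑-+ (allPoints n) _ _)
    where
    distrib : ∀ x d → term (f +ᶠ f′) g x d ≡ term f g x d + term f′ g x d
    distrib x (yes p) = ℚₚ.*-distribʳ-+ (g (x , p)) (f (x , p)) (f′ (x , p))
    distrib x (no _) = sym (ℚₚ.+-identityʳ 0ℚ)

  ⟪⟫-·ˡ : ∀ c f g → ⟪ c ·ᶠ f , g ⟫ ≡ c · ⟪ f , g ⟫
  ⟪⟫-·ˡ c f g = trans (∑-cong (allPoints n) (λ x → assoc x (weight x ≟ i))) (∑-· (allPoints n) c _)
    where
    assoc : ∀ x d → term (c ·ᶠ f) g x d ≡ c · term f g x d
    assoc x (yes p) = ℚₚ.*-assoc c (f (x , p)) (g (x , p))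
    assoc x (no _) = sym (ℚₚ.*-zeroʳ c)

  ⟪⟫-as-∑ : ∀ f g (φ : Point n → ℚ) → (∀ x → f x · g x ≡ φ (proj₁ x)) →
            ⟪ f , g ⟫ ≡ ∑ (allPoints n) (λ x → δ (weight x) i · φ x)
  ⟪⟫-as-∑ f g φ fg≡φ = ∑-cong (allPoints n) (λ x → restrict x (weight x ≟ i))
    where
    restrict : ∀ x d → term f g x d ≡ δ (weight x) i · φ x
    restrict x (yes p) = trans (fg≡φ (x , p)) (sym (trans (cong (_· φ x) (δ-≡ p)) (ℚₚ.*-identityˡ (φ x))))
    restrict x (no ¬p) = sym (trans (cong (_· φ x) (δ-≢ ¬p)) (ℚₚ.*-zeroˡ (φ x)))

  ⟪f,f⟫≡0⇒f≗0 : ∀ f → ⟪ f , f ⟫ ≡ 0ℚ → f ≗ 0ᶠ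
  ⟪f,f⟫≡0⇒f≗0 f ⟪f,f⟫≡0 (x , p) =
    at (weight x ≟ i) (∑-nonneg≡0⇒≡0 (λ x → nonneg x (weight x ≟ i)) ⟪f,f⟫≡0 (∈-allPoints x))
    where
    nonneg : ∀ x d → 0ℚ ≤ℚ term f f x d
    nonneg x (yes p) = x·x-nonneg (f (x , p))
    nonneg x (no _) = ℚₚ.≤-refl
    at : (d : Dec (weight x ≡ i)) → term f f x d ≡ 0ℚ → f (x , p) ≡ 0ℚ
    at (yes q) ff≡0 rewrite ℕₚ.≡-irrelevant p q = x·x≡0⇒x≡0 _ ff≡0
    at (no ¬p) _ = ⊥-elim (¬p p)

record IsSubspace {n i : ℕ} (W : Fun n i → Set) : Set where
  field
    resp-≗ : ∀ {f g} → f ≗ g → W f → W g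
    0ᶠ-closed : W 0ᶠ
    +ᶠ-closed : ∀ {f g} → W f → W g → W (f +ᶠ g)
    ·ᶠ-closed : ∀ c {f} → W f → W (c ·ᶠ f)

  -ᶠ-closed : ∀ {f g} → W f → W g → W (f -ᶠ g)
  -ᶠ-closed {f} {g} wf wg = resp-≗ (λ x → solve 2 (λ a b → a :+ (:- con 1ℚ) :* b := a :- b) refl (f x) (g x))
                                   (+ᶠ-closed wf (·ᶠ-closed (- 1ℚ) wg))

  ∑-closed : {A : Set} (xs : List A) {g : A → Fun n i} → All (λ a → W (g a)) xs →
             W (λ x → ∑ xs (λ a → g a x))
  ∑-closed [] [] = 0ᶠ-closed
  ∑-closed (a ∷ xs) (wa ∷ wxs) = +ᶠ-closed wa (∑-closed xs wxs)

open IsSubspace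

∩-isSubspace : ∀ {n i} {W W′ : Fun n i → Set} → IsSubspace W → IsSubspace W′ →
               IsSubspace (λ f → W f × W′ f)
∩-isSubspace sub sub′ = record
  { resp-≗ = λ f≗g (w , w′) → resp-≗ sub f≗g w , resp-≗ sub′ f≗g w′
  ; 0ᶠ-closed = 0ᶠ-closed sub , 0ᶠ-closed sub′
  ; +ᶠ-closed = λ (w₁ , w₁′) (w₂ , w₂′) → +ᶠ-closed sub w₁ w₂ , +ᶠ-closed sub′ w₁′ w₂′
  ; ·ᶠ-closed = λ c (w , w′) → ·ᶠ-closed sub c w , ·ᶠ-closed sub′ c w′
  }

⇔-isSubspace : ∀ {n i} {W W′ : Fun n i → Set} → (∀ {f} → W f → W′ f) → (∀ {f} → W′ f → W f) →
               IsSubspace W → IsSubspace W′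
⇔-isSubspace to from sub = record
  { resp-≗ = λ f≗g w → to (resp-≗ sub f≗g (from w))
  ; 0ᶠ-closed = to (0ᶠ-closed sub)
  ; +ᶠ-closed = λ w₁ w₂ → to (+ᶠ-closed sub (from w₁) (from w₂))
  ; ·ᶠ-closed = λ c w → to (·ᶠ-closed sub c (from w))
  }

⊥-isSubspace : ∀ {n i} (h : Fun n i) → IsSubspace (λ f → ⟪ f , h ⟫ ≡ 0ℚ)
⊥-isSubspace h = record
  { resp-≗ = λ f≗g ⟪f,h⟫≡0 → trans (sym (⟪⟫-congˡ h f≗g)) ⟪f,h⟫≡0
  ; 0ᶠ-closed = ⟪⟫-zeroˡ h
  ; +ᶠ-closed = λ {f} {g} ⟪f,h⟫≡0 ⟪g,h⟫≡0 →
      trans (⟪⟫-+ˡ f g h) (trans (cong₂ _+_ ⟪f,h⟫≡0 ⟪g,h⟫≡0) (ℚₚ.+-identityʳ 0ℚ))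
  ; ·ᶠ-closed = λ c {f} ⟪f,h⟫≡0 →
      trans (⟪⟫-·ˡ c f h) (trans (cong (c ·_) ⟪f,h⟫≡0) (ℚₚ.*-zeroʳ c))
  }

module _ {n i : ℕ} {A : Set} (P : A → Set) (gen : A → Fun n i) where

  span-isSubspace : IsSubspace (InSpan P gen)
  span-isSubspace = record
    { resp-≗ = λ f≗g (cs , Pcs , f≗∑) → cs , Pcs , λ x → trans (sym (f≗g x)) (f≗∑ x)
    ; 0ᶠ-closed = [] , [] , λ _ → refl
    ; +ᶠ-closed = λ (cs , Pcs , f≗∑) (ds , Pds , g≗∑) →
        cs ++ ds , ++⁺ Pcs Pds , λ x → trans (cong₂ _+_ (f≗∑ x) (g≗∑ x)) (sym (∑-++ cs ds _))
    ; ·ᶠ-closed = λ c (cs , Pcs , f≗∑) →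
        map (scale c) cs , map⁺ Pcs , λ x → trans (cong (c ·_) (f≗∑ x)) (sym (∑-scale c cs x))
    }
    where
    scale : ℚ → A × ℚ → A × ℚ
    scale c p = proj₁ p , c · proj₂ p
    ∑-scale : ∀ c cs x → ∑ (map (scale c) cs) (λ p → proj₂ p · gen (proj₁ p) x) ≡
                         c · ∑ cs (λ p → proj₂ p · gen (proj₁ p) x)
    ∑-scale c cs x = trans (∑-map (scale c) cs _)
      (trans (∑-cong cs (λ p → ℚₚ.*-assoc c (proj₂ p) _)) (∑-· cs c _))

  span-gen : ∀ a → P a → InSpan P gen (gen a)
  span-gen a Pa = (a , 1ℚ) ∷ [] , Pa ∷ [] ,
    λ x → sym (trans (ℚₚ.+-identityʳ _) (ℚₚ.*-identityˡ (gen a x)))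

  span-least : ∀ {W} → IsSubspace W → (∀ {a} → P a → W (gen a)) → ∀ {f} → InSpan P gen f → W f
  span-least sub gen∈W (cs , Pcs , f≗∑) =
    resp-≗ sub (λ x → sym (f≗∑ x))
      (∑-closed sub cs (All.map (λ {p} Pa → ·ᶠ-closed sub (proj₂ p) (gen∈W Pa)) Pcs))

  ⊥-span : ∀ {f h} → (∀ {a} → P a → ⟪ f , gen a ⟫ ≡ 0ℚ) → InSpan P gen h → ⟪ f , h ⟫ ≡ 0ℚ
  ⊥-span {f} f⊥gen h∈span = trans (⟪⟫-comm f _)
    (span-least (⊥-isSubspace f) (λ Pa → trans (⟪⟫-comm _ f) (f⊥gen Pa)) h∈span)

-- U< j is U_{j-1}, and the zero space when j = 0.
U< : ∀ {n i} → ℕ → Fun n i → Set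
U< j = InSpan (λ z → weight z < j) gz

⊥U< : ∀ {n i} → ℕ → Fun n i → Set
⊥U< j f = ∀ w → weight w < j → ⟪ f , gz w ⟫ ≡ 0ℚ

module _ {n i : ℕ} (j : ℕ) where

  U-isSubspace : IsSubspace (U {n} {i} j)
  U-isSubspace = span-isSubspace _ gz

  U<-isSubspace : IsSubspace (U< {n} {i} j)
  U<-isSubspace = span-isSubspace _ gz

  ⊥U<-isSubspace : IsSubspace (⊥U< {n} {i} j)
  ⊥U<-isSubspace = record
    { resp-≗ = λ f≗g f⊥ w w<j → resp-≗ (⊥-isSubspace (gz w)) f≗g (f⊥ w w<j)
    ; 0ᶠ-closed = λ w w<j → 0ᶠ-closed (⊥-isSubspace (gz w))
    ; +ᶠ-closed = λ f⊥ g⊥ w w<j → +ᶠ-closed (⊥-isSubspace (gz w)) (f⊥ w w<j) (g⊥ w w<j)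
    ; ·ᶠ-closed = λ c f⊥ w w<j → ·ᶠ-closed (⊥-isSubspace (gz w)) c (f⊥ w w<j)
    }

  U<⊆U : ∀ {f : Fun n i} → U< j f → U j f
  U<⊆U = span-least _ gz U-isSubspace (λ {w} w<j → span-gen _ gz w (ℕₚ.<⇒≤ w<j))

  U<∩⊥U<⇒≗0 : ∀ {f : Fun n i} → U< j f → ⊥U< j f → f ≗ 0ᶠ
  U<∩⊥U<⇒≗0 {f} f∈U< f⊥U< = ⟪f,f⟫≡0⇒f≗0 f (⊥-span _ gz (λ {w} → f⊥U< w) f∈U<)

V⇒U : ∀ {n i} j {f : Fun n i} → V j f → U j f
V⇒U zero f∈V = f∈V
V⇒U (suc j) = proj₁

V⇒⊥U< : ∀ {n i} j {f : Fun n i} → V j f → ⊥U< j f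
V⇒⊥U< zero _ w ()
V⇒⊥U< (suc j) (_ , f⊥Uj) w (s≤s w≤j) = f⊥Uj (gz w) (span-gen _ gz w w≤j)

U∩⊥U<⇒V : ∀ {n i} j {f : Fun n i} → U j f → ⊥U< j f → V j f
U∩⊥U<⇒V zero f∈U _ = f∈U
U∩⊥U<⇒V (suc j) f∈U f⊥U< = f∈U , λ h h∈Uj → ⊥-span _ gz (λ {w} w≤j → f⊥U< w (s≤s w≤j)) h∈Uj

V-isSubspace : ∀ {n i} j → IsSubspace (V {n} {i} j)
V-isSubspace j = ⇔-isSubspace (λ (f∈U , f⊥U<) → U∩⊥U<⇒V j f∈U f⊥U<)
                              (λ f∈V → V⇒U j f∈V , V⇒⊥U< j f∈V)
                              (∩-isSubspace (U-isSubspace j) (⊥U<-isSubspace j))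

∩-─-weight : ∀ {n} (x y : Point n) → weight (x ∩ y) +ₙ weight (x ─ y) ≡ weight x
∩-─-weight [] [] = refl
∩-─-weight (true ∷ x) (true ∷ y) = cong suc (∩-─-weight x y)
∩-─-weight (true ∷ x) (false ∷ y) = trans (ℕₚ.+-suc _ _) (cong suc (∩-─-weight x y))
∩-─-weight (false ∷ x) (true ∷ y) = ∩-─-weight x y
∩-─-weight (false ∷ x) (false ∷ y) = ∩-─-weight x y

∩-─-weightʳ : ∀ {n} (x y : Point n) → weight (x ∩ y) +ₙ weight (y ─ x) ≡ weight y
∩-─-weightʳ x y = subst (λ z → weight z +ₙ weight (y ─ x) ≡ weight y) (∩-comm y x) (∩-─-weight y x)

∪-weight : ∀ {n} (x y : Point n) → weight (x ∪ y) ≡ weight x +ₙ weight (y ─ x)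
∪-weight [] [] = refl
∪-weight (true ∷ x) (true ∷ y) = cong suc (∪-weight x y)
∪-weight (true ∷ x) (false ∷ y) = cong suc (∪-weight x y)
∪-weight (false ∷ x) (true ∷ y) = trans (cong suc (∪-weight x y)) (sym (ℕₚ.+-suc _ _))
∪-weight (false ∷ x) (false ∷ y) = ∪-weight x y

∁-weight : ∀ {n} (x : Point n) → weight x +ₙ weight (∁ x) ≡ n
∁-weight [] = refl
∁-weight (true ∷ x) = cong suc (∁-weight x)
∁-weight (false ∷ x) = trans (ℕₚ.+-suc _ _) (cong suc (∁-weight x))

overlap-dist : ∀ {n} (x y : Point n) →
               weight (x ∩ y) +ₙ weight (x ∩ y) +ₙ dist x y ≡ weight x +ₙ weight y
overlap-dist [] [] = refl
overlap-dist (true ∷ x) (true ∷ y) = cong suc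
  (trans (cong (_+ₙ dist x y) (ℕₚ.+-suc _ _)) (trans (cong suc (overlap-dist x y)) (sym (ℕₚ.+-suc _ _))))
overlap-dist (true ∷ x) (false ∷ y) = trans (ℕₚ.+-suc _ _) (cong suc (overlap-dist x y))
overlap-dist (false ∷ x) (true ∷ y) =
  trans (ℕₚ.+-suc _ _) (trans (cong suc (overlap-dist x y)) (sym (ℕₚ.+-suc _ _)))
overlap-dist (false ∷ x) (false ∷ y) = overlap-dist x y

m+m≡n+n⇒m≡n : ∀ {m n} → m +ₙ m ≡ n +ₙ n → m ≡ n
m+m≡n+n⇒m≡n {zero} {zero} _ = refl
m+m≡n+n⇒m≡n {suc m} {suc n} eq =
  cong suc (m+m≡n+n⇒m≡n (ℕₚ.suc-injective
    (trans (sym (ℕₚ.+-suc m m)) (trans (ℕₚ.suc-injective eq) (ℕₚ.+-suc n n)))))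

module _ {n : ℕ} (y : Point n) {x x′ : Point n} (∣x∣≡∣x′∣ : weight x ≡ weight x′) where

  private
    overlap-dist≡ : weight (x ∩ y) +ₙ weight (x ∩ y) +ₙ dist x y ≡
                    weight (x′ ∩ y) +ₙ weight (x′ ∩ y) +ₙ dist x′ y
    overlap-dist≡ =
      trans (overlap-dist x y) (trans (cong (_+ₙ weight y) ∣x∣≡∣x′∣) (sym (overlap-dist x′ y)))

  overlap⇒dist : weight (x ∩ y) ≡ weight (x′ ∩ y) → dist x y ≡ dist x′ y
  overlap⇒dist m≡m′ = ℕₚ.+-cancelˡ-≡ (weight (x ∩ y) +ₙ weight (x ∩ y)) _ _
    (trans overlap-dist≡ (cong (λ m → m +ₙ m +ₙ dist x′ y) (sym m≡m′)))

  dist⇒overlap : dist x y ≡ dist x′ y → weight (x ∩ y) ≡ weight (x′ ∩ y)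
  dist⇒overlap d≡d′ = m+m≡n+n⇒m≡n (ℕₚ.+-cancelʳ-≡ (dist x y) _ _
    (trans overlap-dist≡ (cong (weight (x′ ∩ y) +ₙ weight (x′ ∩ y) +ₙ_) (sym d≡d′))))

  overlap⇒excess : weight (x ∩ y) ≡ weight (x′ ∩ y) → weight (x ─ y) ≡ weight (x′ ─ y)
  overlap⇒excess m≡m′ = ℕₚ.+-cancelˡ-≡ (weight (x ∩ y)) _ _
    (trans (∩-─-weight x y) (trans ∣x∣≡∣x′∣
      (trans (sym (∩-─-weight x′ y)) (cong (_+ₙ weight (x′ ─ y)) (sym m≡m′)))))

  overlap⇒outside : weight (x ∩ y) ≡ weight (x′ ∩ y) → weight (∁ (x ∪ y)) ≡ weight (∁ (x′ ∪ y))
  overlap⇒outside m≡m′ = ℕₚ.+-cancelˡ-≡ (weight (x ∪ y)) _ _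
    (trans (∁-weight (x ∪ y))
      (trans (sym (∁-weight (x′ ∪ y))) (cong (_+ₙ weight (∁ (x′ ∪ y))) (sym ∣x∪y∣≡∣x′∪y∣))))
    where
    ∣y─x∣≡∣y─x′∣ : weight (y ─ x) ≡ weight (y ─ x′)
    ∣y─x∣≡∣y─x′∣ = ℕₚ.+-cancelˡ-≡ (weight (x ∩ y)) _ _
      (trans (∩-─-weightʳ x y)
        (trans (sym (∩-─-weightʳ x′ y)) (cong (_+ₙ weight (y ─ x′)) (sym m≡m′))))
    ∣x∪y∣≡∣x′∪y∣ : weight (x ∪ y) ≡ weight (x′ ∪ y)
    ∣x∪y∣≡∣x′∪y∣ =
      trans (∪-weight x y) (trans (cong₂ _+ₙ_ ∣x∣≡∣x′∣ ∣y─x∣≡∣y─x′∣) (sym (∪-weight x′ y)))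

pick : ∀ {n} → Point n → ℕ → ℕ → Point n
pick [] k l = []
pick (true ∷ y) zero l = false ∷ pick y zero l
pick (true ∷ y) (suc k) l = true ∷ pick y k l
pick (false ∷ y) k zero = false ∷ pick y k zero
pick (false ∷ y) k (suc l) = true ∷ pick y k l

pick-overlap : ∀ {n} (y : Point n) {k l : ℕ} → k ≤ weight y → l ≤ weight (∁ y) →
               weight (pick y k l ∩ y) ≡ k
pick-overlap [] z≤n z≤n = refl
pick-overlap (true ∷ y) {zero} z≤n l≤ = pick-overlap y z≤n l≤
pick-overlap (true ∷ y) {suc k} (s≤s k≤) l≤ = cong suc (pick-overlap y k≤ l≤)
pick-overlap (false ∷ y) {l = zero} k≤ z≤n = pick-overlap y k≤ z≤n
pick-overlap (false ∷ y) {l = suc l} k≤ (s≤s l≤) = pick-overlap y k≤ l≤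

pick-excess : ∀ {n} (y : Point n) {k l : ℕ} → k ≤ weight y → l ≤ weight (∁ y) →
              weight (pick y k l ─ y) ≡ l
pick-excess [] z≤n z≤n = refl
pick-excess (true ∷ y) {zero} z≤n l≤ = pick-excess y z≤n l≤
pick-excess (true ∷ y) {suc k} (s≤s k≤) l≤ = pick-excess y k≤ l≤
pick-excess (false ∷ y) {l = zero} k≤ z≤n = pick-excess y k≤ z≤n
pick-excess (false ∷ y) {l = suc l} k≤ (s≤s l≤) = cong suc (pick-excess y k≤ l≤)

pointWithOverlap : ∀ {n i j k} (y : Point n) → weight y ≡ j → j ≤ i → i +ₙ j ≤ n → k ≤ j →
                   Σ (S n i) λ x → weight (proj₁ x ∩ y) ≡ k
pointWithOverlap {n} {i} {j} {k} y ∣y∣≡j j≤i i+j≤n k≤j =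
  (pick y k (i ∸ k) , ∣x∣≡i) , pick-overlap y k≤∣y∣ i∸k≤∣∁y∣
  where
  k≤∣y∣ : k ≤ weight y
  k≤∣y∣ = subst (k ≤_) (sym ∣y∣≡j) k≤j
  i∸k≤∣∁y∣ : i ∸ k ≤ weight (∁ y)
  i∸k≤∣∁y∣ = ℕₚ.+-cancelˡ-≤ j _ _ (begin
    j +ₙ (i ∸ k)           ≤⟨ ℕₚ.+-monoʳ-≤ j (ℕₚ.m∸n≤m i k) ⟩
    j +ₙ i                 ≡⟨ ℕₚ.+-comm j i ⟩
    i +ₙ j                 ≤⟨ i+j≤n ⟩
    n                      ≡⟨ sym (∁-weight y) ⟩
    weight y +ₙ weight (∁ y) ≡⟨ cong (_+ₙ weight (∁ y)) ∣y∣≡j ⟩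
    j +ₙ weight (∁ y)      ∎)
    where open ℕₚ.≤-Reasoning
  ∣x∣≡i : weight (pick y k (i ∸ k)) ≡ i
  ∣x∣≡i = trans (sym (∩-─-weight (pick y k (i ∸ k)) y))
    (trans (cong₂ _+ₙ_ (pick-overlap y k≤∣y∣ i∸k≤∣∁y∣) (pick-excess y k≤∣y∣ i∸k≤∣∁y∣))
      (ℕₚ.m+[n∸m]≡n (ℕₚ.≤-trans k≤j j≤i)))

-- Semi-symmetric functions modulo U_{j-1}

choose : ℕ → ℕ → ℚ
choose _ zero = 1ℚ
choose zero (suc k) = 0ℚ
choose (suc m) (suc k) = choose m k + choose m (suc k)

choose-< : ∀ {m k} → m < k → choose m k ≡ 0ℚ
choose-< {zero} {suc k} _ = refl
choose-< {suc m} {suc k} (s≤s m<k) =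
  trans (cong₂ _+_ (choose-< m<k) (choose-< (ℕₚ.m<n⇒m<1+n m<k))) (ℚₚ.+-identityʳ 0ℚ)

∑< : ℕ → (ℕ → ℚ) → ℚ
∑< zero f = 0ℚ
∑< (suc N) f = f 0 + ∑< N (λ k → f (suc k))

∑<-cong : ∀ N {f g : ℕ → ℚ} → (∀ k → f k ≡ g k) → ∑< N f ≡ ∑< N g
∑<-cong zero f≗g = refl
∑<-cong (suc N) f≗g = cong₂ _+_ (f≗g 0) (∑<-cong N (λ k → f≗g (suc k)))

∑<-zero : ∀ N {f : ℕ → ℚ} → (∀ k → f k ≡ 0ℚ) → ∑< N f ≡ 0ℚ
∑<-zero zero f≗0 = refl
∑<-zero (suc N) f≗0 = trans (cong₂ _+_ (f≗0 0) (∑<-zero N (λ k → f≗0 (suc k)))) (ℚₚ.+-identityʳ 0ℚ)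

∑<-+ : ∀ N (f g : ℕ → ℚ) → ∑< N (λ k → f k + g k) ≡ ∑< N f + ∑< N g
∑<-+ zero f g = sym (ℚₚ.+-identityʳ 0ℚ)
∑<-+ (suc N) f g = trans (cong (f 0 + g 0 +_) (∑<-+ N _ _))
  (solve 4 (λ a b c d → (a :+ b) :+ (c :+ d) := (a :+ c) :+ (b :+ d)) refl
           (f 0) (g 0) (∑< N (λ k → f (suc k))) (∑< N (λ k → g (suc k))))

∑<-last : ∀ N (f : ℕ → ℚ) → ∑< (suc N) f ≡ ∑< N f + f N
∑<-last zero f = trans (ℚₚ.+-identityʳ (f 0)) (sym (ℚₚ.+-identityˡ (f 0)))
∑<-last (suc N) f = trans (cong (f 0 +_) (∑<-last N (λ k → f (suc k)))) (sym (ℚₚ.+-assoc (f 0) _ (f (suc N))))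

∑<-closed : ∀ {n i} {W : Fun n i → Set} → IsSubspace W →
            ∀ N {f : ℕ → Fun n i} → (∀ k → k < N → W (f k)) → W (λ x → ∑< N (λ k → f k x))
∑<-closed sub zero _ = 0ᶠ-closed sub
∑<-closed sub (suc N) f∈W =
  +ᶠ-closed sub (f∈W 0 (s≤s z≤n)) (∑<-closed sub N (λ k k<N → f∈W (suc k) (s≤s k<N)))

Δ^ : ℕ → (ℕ → ℚ) → ℕ → ℚ
Δ^ zero φ = φ
Δ^ (suc k) φ = Δ^ k (λ m → φ (suc m) - φ m)

pascal-∑< : ∀ m N (a : ℕ → ℚ) → ∑< (suc N) (λ k → choose (suc m) k · a k) ≡
            ∑< (suc N) (λ k → choose m k · a k) + ∑< N (λ k → choose m k · a (suc k))
pascal-∑< m N a = begin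
  1ℚ · a 0 + ∑< N (λ k → (choose m k + choose m (suc k)) · a (suc k))
    ≡⟨ cong (1ℚ · a 0 +_) (trans (∑<-cong N (λ k → ℚₚ.*-distribʳ-+ (a (suc k)) (choose m k) (choose m (suc k))))
                                 (∑<-+ N _ _)) ⟩
  1ℚ · a 0 + (∑< N (λ k → choose m k · a (suc k)) + ∑< N (λ k → choose m (suc k) · a (suc k)))
    ≡⟨ solve 3 (λ a b c → a :+ (b :+ c) := (a :+ c) :+ b) refl
               (1ℚ · a 0) (∑< N (λ k → choose m k · a (suc k))) (∑< N (λ k → choose m (suc k) · a (suc k))) ⟩
  1ℚ · a 0 + ∑< N (λ k → choose m (suc k) · a (suc k)) + ∑< N (λ k → choose m k · a (suc k))  ∎
  where open ≡-Reasoning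

newton : ∀ (φ : ℕ → ℚ) m N → m ≤ N → φ m ≡ ∑< (suc N) (λ k → choose m k · Δ^ k φ 0)
newton φ zero N _ = sym (trans (cong (1ℚ · φ 0 +_) (∑<-zero N (λ k → ℚₚ.*-zeroˡ (Δ^ (suc k) φ 0))))
                               (trans (ℚₚ.+-identityʳ _) (ℚₚ.*-identityˡ (φ 0))))
newton φ (suc m) (suc N) (s≤s m≤N) = begin
  φ (suc m)
    ≡⟨ solve 2 (λ a b → a := b :+ (a :- b)) refl (φ (suc m)) (φ m) ⟩
  φ m + (φ (suc m) - φ m)
    ≡⟨ cong₂ _+_ (newton φ m (suc N) (ℕₚ.m≤n⇒m≤1+n m≤N)) (newton (λ m → φ (suc m) - φ m) m N m≤N) ⟩
  ∑< (suc (suc N)) (λ k → choose m k · Δ^ k φ 0) + ∑< (suc N) (λ k → choose m k · Δ^ (suc k) φ 0)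
    ≡⟨ sym (pascal-∑< m (suc N) (λ k → Δ^ k φ 0)) ⟩
  ∑< (suc (suc N)) (λ k → choose (suc m) k · Δ^ k φ 0)  ∎
  where open ≡-Reasoning

subsetsOfSize : ∀ {n} → Point n → ℕ → List (Point n)
subsetsOfSize [] zero = [] ∷ []
subsetsOfSize [] (suc k) = []
subsetsOfSize (true ∷ y) zero = map (false ∷_) (subsetsOfSize y zero)
subsetsOfSize (true ∷ y) (suc k) = map (true ∷_) (subsetsOfSize y k) ++ map (false ∷_) (subsetsOfSize y (suc k))
subsetsOfSize (false ∷ y) k = map (false ∷_) (subsetsOfSize y k)

subsetsOfSize-weight : ∀ {n} (y : Point n) k → All (λ v → weight v ≡ k) (subsetsOfSize y k)
subsetsOfSize-weight [] zero = refl ∷ []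
subsetsOfSize-weight [] (suc k) = []
subsetsOfSize-weight (true ∷ y) zero = map⁺ (subsetsOfSize-weight y zero)
subsetsOfSize-weight (true ∷ y) (suc k) =
  ++⁺ (map⁺ (All.map (cong suc) (subsetsOfSize-weight y k))) (map⁺ (subsetsOfSize-weight y (suc k)))
subsetsOfSize-weight (false ∷ y) k = map⁺ (subsetsOfSize-weight y k)

choose-overlap : ∀ {n} (x y : Point n) k →
                 choose (weight (x ∩ y)) k ≡ ∑ (subsetsOfSize y k) (λ v → χ (subsetᵇ v x))
choose-overlap [] [] zero = sym (ℚₚ.+-identityʳ 1ℚ)
choose-overlap [] [] (suc k) = refl
choose-overlap (a ∷ x) (true ∷ y) zero =
  trans (choose-overlap x y zero) (sym (∑-map (false ∷_) (subsetsOfSize y zero) _))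
choose-overlap (true ∷ x) (true ∷ y) (suc k) = sym (begin
  ∑ (map (true ∷_) (subsetsOfSize y k) ++ map (false ∷_) (subsetsOfSize y (suc k)))
    (λ v → χ (subsetᵇ v (true ∷ x)))
    ≡⟨ ∑-++ (map (true ∷_) (subsetsOfSize y k)) _ _ ⟩
  ∑ (map (true ∷_) (subsetsOfSize y k)) _ + ∑ (map (false ∷_) (subsetsOfSize y (suc k))) _
    ≡⟨ cong₂ _+_ (∑-map (true ∷_) (subsetsOfSize y k) _) (∑-map (false ∷_) (subsetsOfSize y (suc k)) _) ⟩
  ∑ (subsetsOfSize y k) (λ v → χ (subsetᵇ v x)) + ∑ (subsetsOfSize y (suc k)) (λ v → χ (subsetᵇ v x))
    ≡⟨ sym (cong₂ _+_ (choose-overlap x y k) (choose-overlap x y (suc k))) ⟩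
  choose (weight (x ∩ y)) k + choose (weight (x ∩ y)) (suc k)  ∎)
  where open ≡-Reasoning
choose-overlap (false ∷ x) (true ∷ y) (suc k) = sym (begin
  ∑ (map (true ∷_) (subsetsOfSize y k) ++ map (false ∷_) (subsetsOfSize y (suc k)))
    (λ v → χ (subsetᵇ v (false ∷ x)))
    ≡⟨ ∑-++ (map (true ∷_) (subsetsOfSize y k)) _ _ ⟩
  ∑ (map (true ∷_) (subsetsOfSize y k)) _ + ∑ (map (false ∷_) (subsetsOfSize y (suc k))) _
    ≡⟨ cong₂ _+_ (trans (∑-map (true ∷_) (subsetsOfSize y k) _) (∑-zero (subsetsOfSize y k) (λ _ → refl)))
                 (∑-map (false ∷_) (subsetsOfSize y (suc k)) _) ⟩
  0ℚ + ∑ (subsetsOfSize y (suc k)) (λ v → χ (subsetᵇ v x))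
    ≡⟨ trans (ℚₚ.+-identityˡ _) (sym (choose-overlap x y (suc k))) ⟩
  choose (weight (x ∩ y)) (suc k)  ∎)
  where open ≡-Reasoning
choose-overlap (true ∷ x) (false ∷ y) k =
  trans (choose-overlap x y k) (sym (∑-map (false ∷_) (subsetsOfSize y k) _))
choose-overlap (false ∷ x) (false ∷ y) k =
  trans (choose-overlap x y k) (sym (∑-map (false ∷_) (subsetsOfSize y k) _))

∩-weight≤ : ∀ {n} (x y : Point n) → weight (x ∩ y) ≤ weight y
∩-weight≤ x y = subst (weight (x ∩ y) ≤_) (∩-─-weightʳ x y) (ℕₚ.m≤m+n _ _)

gz-overlap : ∀ {n} (x y : Point n) → χ (subsetᵇ y x) ≡ choose (weight (x ∩ y)) (weight y)
gz-overlap [] [] = refl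
gz-overlap (true ∷ x) (true ∷ y) =
  trans (gz-overlap x y) (sym (trans (cong (choose (weight (x ∩ y)) (weight y) +_) (choose-< (s≤s (∩-weight≤ x y))))
                                    (ℚₚ.+-identityʳ _)))
gz-overlap (false ∷ x) (true ∷ y) = sym (choose-< (s≤s (∩-weight≤ x y)))
gz-overlap (true ∷ x) (false ∷ y) = gz-overlap x y
gz-overlap (false ∷ x) (false ∷ y) = gz-overlap x y

module _ {n i j : ℕ} (y : Point n) (∣y∣≡j : weight y ≡ j) where

  overlap≤j : ∀ (x : S n i) → weight (proj₁ x ∩ y) ≤ j
  overlap≤j x = subst (weight (proj₁ x ∩ y) ≤_) ∣y∣≡j (∩-weight≤ (proj₁ x) y)

  choose-overlap∈U< : ∀ {k} → k < j → U< {n} {i} j (λ x → choose (weight (proj₁ x ∩ y)) k)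
  choose-overlap∈U< {k} k<j = resp-≗ (U<-isSubspace j) (λ x → sym (choose-overlap (proj₁ x) y k))
    (∑-closed (U<-isSubspace j) (subsetsOfSize y k)
      (All.map (λ {v} ∣v∣≡k → span-gen _ gz v (subst (_< j) (sym ∣v∣≡k) k<j)) (subsetsOfSize-weight y k)))

  overlapProfile : j ≤ i → i +ₙ j ≤ n → {G : Fun n i} → SemiSymmetric y G →
                   Σ (ℕ → ℚ) λ φ → ∀ x → G x ≡ φ (weight (proj₁ x ∩ y))
  overlapProfile j≤i i+j≤n {G} G-ss = φ , G≡φ
    where
    witness : ∀ {k} → k ≤ j → Σ (S n i) λ x → weight (proj₁ x ∩ y) ≡ k
    witness = pointWithOverlap y ∣y∣≡j j≤i i+j≤n
    φ : ℕ → ℚ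
    φ k with k ℕ.≤? j
    ... | yes k≤j = G (proj₁ (witness k≤j))
    ... | no _ = 0ℚ
    G≡φ : ∀ x → G x ≡ φ (weight (proj₁ x ∩ y))
    G≡φ x with weight (proj₁ x ∩ y) ℕ.≤? j
    ... | yes m≤j =
      G-ss x x′ (overlap⇒dist y {proj₁ x} {proj₁ x′} (trans (proj₂ x) (sym (proj₂ x′))) (sym (proj₂ (witness m≤j))))
      where
      x′ : S n i
      x′ = proj₁ (witness m≤j)
    ... | no m≰j = ⊥-elim (m≰j (overlap≤j x))

  semiSymmetric-decomposition : j ≤ i → i +ₙ j ≤ n → {G : Fun n i} → SemiSymmetric y G →
                                Σ ℚ λ D → U< j (G -ᶠ D ·ᶠ gz y)
  semiSymmetric-decomposition j≤i i+j≤n {G} G-ss = Δ^ j φ 0 , resp-≗ (U<-isSubspace j) lower≗ lower∈U<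
    where
    φ : ℕ → ℚ
    φ = proj₁ (overlapProfile j≤i i+j≤n G-ss)
    lower : Fun n i
    lower x = ∑< j (λ k → choose (weight (proj₁ x ∩ y)) k · Δ^ k φ 0)
    lower∈U< : U< j lower
    lower∈U< = ∑<-closed (U<-isSubspace j) j
      (λ k k<j → resp-≗ (U<-isSubspace j) (λ x → ℚₚ.*-comm (Δ^ k φ 0) _)
                                           (·ᶠ-closed (U<-isSubspace j) (Δ^ k φ 0) (choose-overlap∈U< k<j)))
    lower≗ : lower ≗ G -ᶠ Δ^ j φ 0 ·ᶠ gz y
    lower≗ x = sym (begin
      G x - D · gz y x
        ≡⟨ cong₂ (λ u v → u - D · v) (trans (proj₂ (overlapProfile j≤i i+j≤n G-ss) x) (newton φ m j (overlap≤j x)))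
                                       (trans (gz-overlap (proj₁ x) y) (cong (choose m) ∣y∣≡j)) ⟩
      ∑< (suc j) (λ k → choose m k · Δ^ k φ 0) - D · choose m j
        ≡⟨ cong (_- D · choose m j) (∑<-last j _) ⟩
      lower x + choose m j · D - D · choose m j
        ≡⟨ solve 3 (λ l c d → l :+ c :* d :- d :* c := l) refl (lower x) (choose m j) D ⟩
      lower x  ∎)
      where
      open ≡-Reasoning
      m : ℕ
      m = weight (proj₁ x ∩ y)
      D : ℚ
      D = Δ^ j φ 0

  semiSymmetric⇒U : j ≤ i → i +ₙ j ≤ n → {G : Fun n i} → SemiSymmetric y G → U j G
  semiSymmetric⇒U j≤i i+j≤n {G} G-ss =
    resp-≗ (U-isSubspace j) (λ x → solve 2 (λ g e → g :- e :+ e := g) refl (G x) (D · gz y x))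
      (+ᶠ-closed (U-isSubspace j) (U<⊆U j lower∈U<)
                                  (·ᶠ-closed (U-isSubspace j) D (span-gen _ gz y (ℕₚ.≤-reflexive ∣y∣≡j))))
    where
    D : ℚ
    D = proj₁ (semiSymmetric-decomposition j≤i i+j≤n G-ss)
    lower∈U< : U< j (G -ᶠ D ·ᶠ gz y)
    lower∈U< = proj₂ (semiSymmetric-decomposition j≤i i+j≤n G-ss)

-- Uniqueness of semi-symmetric elements of V_j

∩-⊆ : ∀ {n} (x y : Point n) → subsetᵇ (x ∩ y) x ≡ true
∩-⊆ [] [] = refl
∩-⊆ (true ∷ x) (true ∷ y) = ∩-⊆ x y
∩-⊆ (true ∷ x) (false ∷ y) = ∩-⊆ x y
∩-⊆ (false ∷ x) (b ∷ y) = ∩-⊆ x y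

∩-⊆⇒overlap≤ : ∀ {n} (x x′ y : Point n) → subsetᵇ (x ∩ y) x′ ≡ true →
               weight (x ∩ y) ≤ weight (x′ ∩ y)
∩-⊆⇒overlap≤ [] [] [] _ = z≤n
∩-⊆⇒overlap≤ (true ∷ x) (true ∷ x′) (true ∷ y) ⊆ = s≤s (∩-⊆⇒overlap≤ x x′ y ⊆)
∩-⊆⇒overlap≤ (true ∷ x) (false ∷ x′) (true ∷ y) ()
∩-⊆⇒overlap≤ (true ∷ x) (b ∷ x′) (false ∷ y) ⊆ = ℕₚ.≤-trans (∩-⊆⇒overlap≤ x x′ y ⊆) (∩-overlap-step b)
  where
  ∩-overlap-step : ∀ b → weight (x′ ∩ y) ≤ weight ((b ∷ x′) ∩ (false ∷ y))
  ∩-overlap-step true = ℕₚ.≤-refl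
  ∩-overlap-step false = ℕₚ.≤-refl
∩-⊆⇒overlap≤ (false ∷ x) (true ∷ x′) (true ∷ y) ⊆ = ℕₚ.m≤n⇒m≤1+n (∩-⊆⇒overlap≤ x x′ y ⊆)
∩-⊆⇒overlap≤ (false ∷ x) (false ∷ x′) (true ∷ y) ⊆ = ∩-⊆⇒overlap≤ x x′ y ⊆
∩-⊆⇒overlap≤ (false ∷ x) (true ∷ x′) (false ∷ y) ⊆ = ∩-⊆⇒overlap≤ x x′ y ⊆
∩-⊆⇒overlap≤ (false ∷ x) (false ∷ x′) (false ∷ y) ⊆ = ∩-⊆⇒overlap≤ x x′ y ⊆

module _ {n i j : ℕ} (y : Point n) (∣y∣≡j : weight y ≡ j) {H : Fun n i} (H-ss : SemiSymmetric y H) where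

  private
    common : S n i → ℕ
    common x = weight (proj₁ x ∩ y)

    H-overlap : ∀ x x′ → common x ≡ common x′ → H x ≡ H x′
    H-overlap x x′ m≡m′ =
      H-ss x x′ (overlap⇒dist y {proj₁ x} {proj₁ x′} (trans (proj₂ x) (sym (proj₂ x′))) m≡m′)

  sameOverlapCount : S n i → ℚ
  sameOverlapCount x = ∑ (allPoints n)
    (λ x′ → δ (weight x′) i · (χ (subsetᵇ (proj₁ x ∩ y) x′) · δ (weight (x′ ∩ y)) (common x)))

  sameOverlapCount≢0 : ∀ x → sameOverlapCount x ≢ 0ℚ
  sameOverlapCount≢0 (x , ∣x∣≡i) count≡0 = 1≢0 (begin
    1ℚ                                ≡⟨ sym (ℚₚ.*-identityʳ 1ℚ) ⟩
    1ℚ · 1ℚ                           ≡⟨ sym (cong₂ _·_ (δ-≡ ∣x∣≡i)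
                                                       (cong₂ _·_ (cong χ (∩-⊆ x y)) (δ-≡ {weight (x ∩ y)} refl))) ⟩
    term-at x                         ≡⟨ ∑-nonneg≡0⇒≡0 term-nonneg count≡0 (∈-allPoints x) ⟩
    0ℚ                                ∎)
    where
    open ≡-Reasoning
    1≢0 : 1ℚ ≢ 0ℚ
    1≢0 ()
    term-at : Point n → ℚ
    term-at x′ = δ (weight x′) i · (χ (subsetᵇ (x ∩ y) x′) · δ (weight (x′ ∩ y)) (weight (x ∩ y)))
    term-nonneg : ∀ x′ → 0ℚ ≤ℚ term-at x′
    term-nonneg x′ = ·-nonneg (δ-nonneg (weight x′) i)
                              (·-nonneg (χ-nonneg (subsetᵇ (x ∩ y) x′)) (δ-nonneg (weight (x′ ∩ y)) _))

  ⟪H,g[x∩y]⟫ : ∀ x → (∀ x′ → common x < common x′ → H x′ ≡ 0ℚ) →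
                ⟪ H , gz (proj₁ x ∩ y) ⟫ ≡ H x · sameOverlapCount x
  ⟪H,g[x∩y]⟫ x H-above≡0 = trans (⟪⟫-as-∑ H (gz (proj₁ x ∩ y)) (λ x′ → H x · ι x′) pointwise)
    (trans (∑-cong (allPoints n)
             (λ x′ → solve 3 (λ d h c → d :* (h :* c) := h :* (d :* c)) refl (δ (weight x′) i) (H x) (ι x′)))
           (∑-· (allPoints n) (H x) (λ x′ → δ (weight x′) i · ι x′)))
    where
    ι : Point n → ℚ
    ι x′ = χ (subsetᵇ (proj₁ x ∩ y) x′) · δ (weight (x′ ∩ y)) (common x)
    pointwise : ∀ x′ → H x′ · gz (proj₁ x ∩ y) x′ ≡ H x · ι (proj₁ x′)
    pointwise x′ with subsetᵇ (proj₁ x ∩ y) (proj₁ x′) in x∩y⊆x′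
    ... | false = trans (ℚₚ.*-zeroʳ (H x′))
                        (sym (trans (cong (H x ·_) (ℚₚ.*-zeroˡ (δ (common x′) (common x)))) (ℚₚ.*-zeroʳ (H x))))
    ... | true with common x′ ≟ common x
    ...   | yes m′≡m = trans (ℚₚ.*-identityʳ (H x′))
                         (trans (H-overlap x′ x m′≡m) (sym (trans (cong (λ u → H x · (1ℚ · u)) (δ-≡ m′≡m))
                           (trans (cong (H x ·_) (ℚₚ.*-identityˡ 1ℚ)) (ℚₚ.*-identityʳ (H x))))))
    ...   | no m′≢m = trans (cong (_· 1ℚ) (H-above≡0 x′ m<m′))
                         (sym (trans (cong (λ u → H x · (1ℚ · u)) (δ-≢ m′≢m)) (ℚₚ.*-zeroʳ (H x))))
      where
      m<m′ : common x < common x′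
      m<m′ = ℕₚ.≤∧≢⇒< (∩-⊆⇒overlap≤ (proj₁ x) (proj₁ x′) y x∩y⊆x′) (λ m≡m′ → m′≢m (sym m≡m′))

  semiSymmetric-⊥U<-vanishes : ⊥U< j H → (x₀ : S n i) → common x₀ ≡ j → H x₀ ≡ 0ℚ → H ≗ 0ᶠ
  semiSymmetric-⊥U<-vanishes H⊥U< x₀ m₀≡j H[x₀]≡0 x = below j x (ℕₚ.m≤m+n j _)
    where
    -- downward induction on the overlap: d bounds j − |x ∩ y|
    below : ∀ d x → j ≤ d +ₙ common x → H x ≡ 0ℚ
    below zero x j≤m = trans (H-overlap x x₀ (trans m≡j (sym m₀≡j))) H[x₀]≡0
      where
      m≡j : common x ≡ j
      m≡j = ℕₚ.≤-antisym (overlap≤j y ∣y∣≡j x) j≤m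
    below (suc d) x j≤1+d+m with j ℕ.≤? d +ₙ common x
    ... | yes j≤d+m = below d x j≤d+m
    ... | no j≰d+m = y≢0⇒x·y≡0⇒x≡0 (H x) _ (sameOverlapCount≢0 x)
                       (trans (sym (⟪H,g[x∩y]⟫ x above≡0)) (H⊥U< (proj₁ x ∩ y) m<j))
      where
      j≡1+d+m : j ≡ suc (d +ₙ common x)
      j≡1+d+m = ℕₚ.≤-antisym j≤1+d+m (ℕₚ.≰⇒> j≰d+m)
      m<j : common x < j
      m<j = subst (common x <_) (sym j≡1+d+m) (s≤s (ℕₚ.m≤n+m (common x) d))
      above≡0 : ∀ x′ → common x < common x′ → H x′ ≡ 0ℚ
      above≡0 x′ m<m′ = below d x′ (subst (_≤ d +ₙ common x′) (sym j≡1+d+m) (ℕₚ.+-monoʳ-< d m<m′))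

-- Binomial sums

fromℕ : ℕ → ℚ
fromℕ zero = 0ℚ
fromℕ (suc k) = 1ℚ + fromℕ k

fromℕ-+ : ∀ a b → fromℕ (a +ₙ b) ≡ fromℕ a + fromℕ b
fromℕ-+ zero b = sym (ℚₚ.+-identityˡ (fromℕ b))
fromℕ-+ (suc a) b = trans (cong (1ℚ +_) (fromℕ-+ a b)) (sym (ℚₚ.+-assoc 1ℚ (fromℕ a) (fromℕ b)))

fromℕ-∸ : ∀ {m k} → k ≤ m → fromℕ (m ∸ k) ≡ fromℕ m - fromℕ k
fromℕ-∸ {m} {k} k≤m =
  trans (solve 2 (λ a c → a := (a :+ c) :- c) refl (fromℕ (m ∸ k)) (fromℕ k))
        (cong (_- fromℕ k) (trans (sym (fromℕ-+ (m ∸ k) k)) (cong fromℕ (ℕₚ.m∸n+n≡m k≤m))))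

fromℕ-nonneg : ∀ k → 0ℚ ≤ℚ fromℕ k
fromℕ-nonneg zero = ℚₚ.≤-refl
fromℕ-nonneg (suc k) = ℚₚ.+-mono-≤ (ℚₚ.nonNegative⁻¹ 1ℚ) (fromℕ-nonneg k)

fromℕ-suc-pos : ∀ k → 0ℚ <ℚ fromℕ (suc k)
fromℕ-suc-pos k = ℚₚ.+-mono-<-≤ (ℚₚ.positive⁻¹ 1ℚ) (fromℕ-nonneg k)

factorial : ℕ → ℚ
factorial zero = 1ℚ
factorial (suc k) = fromℕ (suc k) · factorial k

factorial-pos : ∀ k → 0ℚ <ℚ factorial k
factorial-pos zero = ℚₚ.positive⁻¹ 1ℚ
factorial-pos (suc k) = ·-pos (fromℕ-suc-pos k) (factorial-pos k)

−1^_ : ℕ → ℚ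
−1^ zero = 1ℚ
−1^ suc k = - (−1^ k)

−1^-+ : ∀ a b → −1^ (a +ₙ b) ≡ −1^ a · −1^ b
−1^-+ zero b = sym (ℚₚ.*-identityˡ (−1^ b))
−1^-+ (suc a) b = trans (cong -_ (−1^-+ a b)) (ℚₚ.neg-distribˡ-* (−1^ a) (−1^ b))

−1^≢0 : ∀ k → −1^ k ≢ 0ℚ
−1^≢0 zero ()
−1^≢0 (suc k) −1^k≡0 = −1^≢0 k (ℚₚ.neg-injective −1^k≡0)

risingProduct : ℕ → ℚ → ℚ
risingProduct zero z = 1ℚ
risingProduct (suc b) z = risingProduct b z · (z + fromℕ (suc b))

factorial-+ : ∀ t b → factorial (t +ₙ b) ≡ factorial t · risingProduct b (fromℕ t)
factorial-+ t zero = trans (cong factorial (ℕₚ.+-identityʳ t)) (sym (ℚₚ.*-identityʳ (factorial t)))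
factorial-+ t (suc b) = begin
  factorial (t +ₙ suc b)
    ≡⟨ cong factorial (ℕₚ.+-suc t b) ⟩
  fromℕ (suc (t +ₙ b)) · factorial (t +ₙ b)
    ≡⟨ cong₂ _·_ (cong (1ℚ +_) (fromℕ-+ t b)) (factorial-+ t b) ⟩
  (1ℚ + (fromℕ t + fromℕ b)) · (factorial t · risingProduct b (fromℕ t))
    ≡⟨ solve 4 (λ x y f r → (con 1ℚ :+ (x :+ y)) :* (f :* r) := f :* (r :* (x :+ (con 1ℚ :+ y)))) refl
               (fromℕ t) (fromℕ b) (factorial t) (risingProduct b (fromℕ t)) ⟩
  factorial t · risingProduct (suc b) (fromℕ t)
    ∎
  where open ≡-Reasoning

risingProduct-root : ∀ b u → 1 ≤ u → u ≤ b → risingProduct b (- fromℕ u) ≡ 0ℚ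
risingProduct-root zero (suc u) _ ()
risingProduct-root (suc b) u 1≤u u≤1+b with u ≟ suc b
... | yes refl = trans (cong (risingProduct b (- fromℕ u) ·_) (ℚₚ.+-inverseˡ (fromℕ u)))
                      (ℚₚ.*-zeroʳ (risingProduct b (- fromℕ u)))
... | no u≢1+b = trans (cong (_· (- fromℕ u + fromℕ (suc b)))
                             (risingProduct-root b u 1≤u (ℕₚ.≤-pred (ℕₚ.≤∧≢⇒< u≤1+b u≢1+b))))
                       (ℚₚ.*-zeroˡ (- fromℕ u + fromℕ (suc b)))

risingProduct-shift : ∀ b z → risingProduct (suc b) (z - 1ℚ) ≡ z · risingProduct b z
risingProduct-shift zero z =
  solve 1 (λ z → con 1ℚ :* ((z :- con 1ℚ) :+ (con 1ℚ :+ con 0ℚ)) := z :* con 1ℚ) refl z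
risingProduct-shift (suc b) z = trans (cong (_· (z - 1ℚ + fromℕ (suc (suc b)))) (risingProduct-shift b z))
  (solve 3 (λ z r x → (z :* r) :* ((z :- con 1ℚ) :+ (con 1ℚ :+ (con 1ℚ :+ x)))
                   := z :* (r :* (z :+ (con 1ℚ :+ x))))
         refl z (risingProduct b z) (fromℕ b))

risingProduct-Δ : ∀ b z → risingProduct (suc b) z - risingProduct (suc b) (z - 1ℚ) ≡
                          fromℕ (suc b) · risingProduct b z
risingProduct-Δ b z = trans (cong (λ r → risingProduct (suc b) z - r) (risingProduct-shift b z))
  (solve 3 (λ z r x → r :* (z :+ x) :- z :* r := x :* r) refl z (risingProduct b z) (fromℕ (suc b)))

-- cubeSum s G = ∑ over u ∈ {0,1}ˢ of G (number of ones in u) (number of zeros in u)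
cubeSum : ℕ → (ℕ → ℕ → ℚ) → ℚ
cubeSum zero G = G 0 0
cubeSum (suc s) G = cubeSum s (λ d d′ → G (suc d) d′) + cubeSum s (λ d d′ → G d (suc d′))

cubeSum-cong : ∀ s {G G′ : ℕ → ℕ → ℚ} → (∀ d d′ → d +ₙ d′ ≡ s → G d d′ ≡ G′ d d′) →
               cubeSum s G ≡ cubeSum s G′
cubeSum-cong zero G≗G′ = G≗G′ 0 0 refl
cubeSum-cong (suc s) G≗G′ =
  cong₂ _+_ (cubeSum-cong s (λ d d′ p → G≗G′ (suc d) d′ (cong suc p)))
            (cubeSum-cong s (λ d d′ p → G≗G′ d (suc d′) (trans (ℕₚ.+-suc d d′) (cong suc p))))

cubeSum-+ : ∀ s (G H : ℕ → ℕ → ℚ) → cubeSum s (λ d d′ → G d d′ + H d d′) ≡ cubeSum s G + cubeSum s H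
cubeSum-+ zero G H = refl
cubeSum-+ (suc s) G H = trans (cong₂ _+_ (cubeSum-+ s _ _) (cubeSum-+ s _ _))
  (solve 4 (λ a b c d → (a :+ b) :+ (c :+ d) := (a :+ c) :+ (b :+ d)) refl
     (cubeSum s (λ d d′ → G (suc d) d′)) (cubeSum s (λ d d′ → H (suc d) d′))
     (cubeSum s (λ d d′ → G d (suc d′))) (cubeSum s (λ d d′ → H d (suc d′))))

cubeSum-· : ∀ s c (G : ℕ → ℕ → ℚ) → cubeSum s (λ d d′ → c · G d d′) ≡ c · cubeSum s G
cubeSum-· zero c G = refl
cubeSum-· (suc s) c G = trans (cong₂ _+_ (cubeSum-· s c _) (cubeSum-· s c _)) (sym (ℚₚ.*-distribˡ-+ c _ _))

cubeSum-zero : ∀ s {G : ℕ → ℕ → ℚ} → (∀ d d′ → d +ₙ d′ ≡ s → G d d′ ≡ 0ℚ) → cubeSum s G ≡ 0ℚ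
cubeSum-zero s {G} G≗0 = begin
  cubeSum s G                         ≡⟨ cubeSum-cong s (λ d d′ p → trans (G≗0 d d′ p) (sym (ℚₚ.*-zeroˡ 0ℚ))) ⟩
  cubeSum s (λ _ _ → 0ℚ · 0ℚ)         ≡⟨ cubeSum-· s 0ℚ (λ _ _ → 0ℚ) ⟩
  0ℚ · cubeSum s (λ _ _ → 0ℚ)         ≡⟨ ℚₚ.*-zeroˡ (cubeSum s (λ _ _ → 0ℚ)) ⟩
  0ℚ                                  ∎
  where open ≡-Reasoning

cubeSum-δ-factorial-suc : ∀ s t → cubeSum s (λ d d′ → δ d t · factorial (suc d′)) ≡
                                  fromℕ (suc s ∸ t) · cubeSum s (λ d d′ → δ d t · factorial d′)
cubeSum-δ-factorial-suc s t = trans (cubeSum-cong s pointwise) (cubeSum-· s (fromℕ (suc s ∸ t)) _)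
  where
  pointwise : ∀ d d′ → d +ₙ d′ ≡ s →
              δ d t · factorial (suc d′) ≡ fromℕ (suc s ∸ t) · (δ d t · factorial d′)
  pointwise d d′ d+d′≡s with d ≟ t
  ... | yes refl = trans (cong (λ a → δ d d · (fromℕ a · factorial d′)) 1+d′≡1+s∸d)
                     (solve 3 (λ δ a f → δ :* (a :* f) := a :* (δ :* f)) refl (δ d d) (fromℕ (suc s ∸ d)) (factorial d′))
    where
    1+d′≡1+s∸d : suc d′ ≡ suc s ∸ d
    1+d′≡1+s∸d = sym (trans (cong (λ m → suc m ∸ d) (sym d+d′≡s))
                            (trans (cong (_∸ d) (sym (ℕₚ.+-suc d d′))) (ℕₚ.m+n∸m≡n d (suc d′))))
  ... | no d≢t = trans (δ-≢-· d≢t (factorial (suc d′)))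
                       (sym (trans (cong (fromℕ (suc s ∸ t) ·_) (δ-≢-· d≢t (factorial d′)))
                                   (ℚₚ.*-zeroʳ (fromℕ (suc s ∸ t)))))

cubeSum-δ-factorial : ∀ s t → t ≤ s →
                      factorial t · cubeSum s (λ d d′ → δ d t · factorial d′) ≡ factorial s
cubeSum-δ-factorial zero zero z≤n = refl
cubeSum-δ-factorial (suc s) t t≤1+s = begin
  factorial t · (cubeSum s (λ d d′ → δ (suc d) t · factorial d′) +
                 cubeSum s (λ d d′ → δ d t · factorial (suc d′)))
    ≡⟨ ℚₚ.*-distribˡ-+ (factorial t) _ _ ⟩
  factorial t · cubeSum s (λ d d′ → δ (suc d) t · factorial d′) +
  factorial t · cubeSum s (λ d d′ → δ d t · factorial (suc d′))
    ≡⟨ cong₂ _+_ (oneMore t t≤1+s) (trans (cong (factorial t ·_) (cubeSum-δ-factorial-suc s t)) zeroMore) ⟩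
  fromℕ t · factorial s + fromℕ (suc s ∸ t) · factorial s
    ≡⟨ sym (ℚₚ.*-distribʳ-+ (factorial s) (fromℕ t) _) ⟩
  (fromℕ t + fromℕ (suc s ∸ t)) · factorial s
    ≡⟨ cong (_· factorial s) (trans (sym (fromℕ-+ t _)) (cong fromℕ (ℕₚ.m+[n∸m]≡n t≤1+s))) ⟩
  factorial (suc s)  ∎
  where
  open ≡-Reasoning
  oneMore : ∀ t → t ≤ suc s →
            factorial t · cubeSum s (λ d d′ → δ (suc d) t · factorial d′) ≡ fromℕ t · factorial s
  oneMore zero _ = trans (ℚₚ.*-identityˡ _) (trans (cubeSum-zero s (λ d d′ _ → ℚₚ.*-zeroˡ (factorial d′)))
                                                   (sym (ℚₚ.*-zeroˡ (factorial s))))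
  oneMore (suc t) (s≤s t≤s) = trans (ℚₚ.*-assoc (fromℕ (suc t)) (factorial t) _)
                                    (cong (fromℕ (suc t) ·_) (cubeSum-δ-factorial s t t≤s))
  c C : ℚ
  c = fromℕ (suc s ∸ t)
  C = cubeSum s (λ d d′ → δ d t · factorial d′)
  zeroMore : factorial t · (c · C) ≡ c · factorial s
  zeroMore with ℕₚ.m≤n⇒m<n∨m≡n t≤1+s
  ... | inj₁ (s≤s t≤s) = trans (solve 3 (λ f c C → f :* (c :* C) := c :* (f :* C)) refl (factorial t) c C)
                               (cong (c ·_) (cubeSum-δ-factorial s t t≤s))
  ... | inj₂ refl rewrite ℕₚ.n∸n≡0 s =
    trans (cong (factorial t ·_) (ℚₚ.*-zeroˡ C)) (trans (ℚₚ.*-zeroʳ (factorial t)) (sym (ℚₚ.*-zeroˡ (factorial s))))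

cubeSum-δ-≤ : ∀ b s k i → k ≤ i → i ≤ k +ₙ s →
              cubeSum s (λ d d′ → δ (d +ₙ k) i · (factorial (d +ₙ b) · factorial d′)) ≡
              factorial s · risingProduct b (fromℕ (i ∸ k))
cubeSum-δ-≤ b s k i k≤i i≤k+s = begin
  cubeSum s (λ d d′ → δ (d +ₙ k) i · (factorial (d +ₙ b) · factorial d′))
    ≡⟨ cubeSum-cong s (λ d d′ _ → onlyT d d′) ⟩
  cubeSum s (λ d d′ → factorial (t +ₙ b) · (δ d t · factorial d′))
    ≡⟨ cubeSum-· s (factorial (t +ₙ b)) _ ⟩
  factorial (t +ₙ b) · C
    ≡⟨ cong (_· C) (factorial-+ t b) ⟩
  factorial t · risingProduct b (fromℕ t) · C
    ≡⟨ solve 3 (λ f r C → f :* r :* C := f :* C :* r) refl (factorial t) (risingProduct b (fromℕ t)) C ⟩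
  factorial t · C · risingProduct b (fromℕ t)
    ≡⟨ cong (_· risingProduct b (fromℕ t)) (cubeSum-δ-factorial s t (ℕₚ.m≤n+o⇒m∸n≤o i k i≤k+s)) ⟩
  factorial s · risingProduct b (fromℕ t)  ∎
  where
  open ≡-Reasoning
  t : ℕ
  t = i ∸ k
  C : ℚ
  C = cubeSum s (λ d d′ → δ d t · factorial d′)
  onlyT : ∀ d d′ → δ (d +ₙ k) i · (factorial (d +ₙ b) · factorial d′) ≡
                   factorial (t +ₙ b) · (δ d t · factorial d′)
  onlyT d d′ = begin
    δ (d +ₙ k) i · (factorial (d +ₙ b) · factorial d′)
      ≡⟨ cong (_· (factorial (d +ₙ b) · factorial d′))
              (δ-cong (λ d+k≡i → trans (sym (ℕₚ.m+n∸n≡m d k)) (cong (_∸ k) d+k≡i))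
                      (λ d≡t → trans (cong (_+ₙ k) d≡t) (ℕₚ.m∸n+n≡m k≤i))) ⟩
    δ d t · (factorial (d +ₙ b) · factorial d′)
      ≡⟨ δ-subst d t (λ e → factorial (e +ₙ b) · factorial d′) ⟩
    δ d t · (factorial (t +ₙ b) · factorial d′)
      ≡⟨ solve 3 (λ δ f g → δ :* (f :* g) := f :* (δ :* g)) refl (δ d t) (factorial (t +ₙ b)) (factorial d′) ⟩
    factorial (t +ₙ b) · (δ d t · factorial d′)  ∎

cubeSum-δ-> : ∀ b s k i → i < k →
              cubeSum s (λ d d′ → δ (d +ₙ k) i · (factorial (d +ₙ b) · factorial d′)) ≡ 0ℚ
cubeSum-δ-> b s k i i<k = cubeSum-zero s (λ d d′ _ → δ-≢-· (d+k≢i d) (factorial (d +ₙ b) · factorial d′))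
  where
  d+k≢i : ∀ d → d +ₙ k ≢ i
  d+k≢i d d+k≡i = ℕₚ.<⇒≱ i<k (subst (k ≤_) d+k≡i (ℕₚ.m≤n+m k d))

-- The δ selects d = i − k, and (d + b)! / d! = risingProduct b d; when k > i the left side is 0,
-- and so is the right side, since i − k is one of the roots −1, …, −b of risingProduct b.
cubeSum-δ : ∀ b s k i → i ≤ k +ₙ s → k ≤ i +ₙ b →
            cubeSum s (λ d d′ → δ (d +ₙ k) i · (factorial (d +ₙ b) · factorial d′)) ≡
            factorial s · risingProduct b (fromℕ i - fromℕ k)
cubeSum-δ b s k i i≤k+s k≤i+b with k ℕ.≤? i
... | yes k≤i =
  trans (cubeSum-δ-≤ b s k i k≤i i≤k+s) (cong (λ v → factorial s · risingProduct b v) (fromℕ-∸ k≤i))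
... | no k≰i = begin
  cubeSum s (λ d d′ → δ (d +ₙ k) i · (factorial (d +ₙ b) · factorial d′))
    ≡⟨ cubeSum-δ-> b s k i i<k ⟩
  0ℚ
    ≡⟨ sym (ℚₚ.*-zeroʳ (factorial s)) ⟩
  factorial s · 0ℚ
    ≡⟨ cong (factorial s ·_)
            (sym (risingProduct-root b (k ∸ i) (ℕₚ.m<n⇒0<n∸m i<k) (ℕₚ.m≤n+o⇒m∸n≤o k i k≤i+b))) ⟩
  factorial s · risingProduct b (- fromℕ (k ∸ i))
    ≡⟨ cong (λ v → factorial s · risingProduct b (- v)) (fromℕ-∸ (ℕₚ.<⇒≤ i<k)) ⟩
  factorial s · risingProduct b (- (fromℕ k - fromℕ i))
    ≡⟨ cong (λ v → factorial s · risingProduct b v)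
            (solve 2 (λ k i → :- (k :- i) := i :- k) refl (fromℕ k) (fromℕ i)) ⟩
  factorial s · risingProduct b (fromℕ i - fromℕ k)  ∎
  where
  open ≡-Reasoning
  i<k : i < k
  i<k = ℕₚ.≰⇒> k≰i

-- alternatingSum q f = ∑_c (−1)^c C(q,c) f(c), that is (−1)^q times the q-th forward difference of f at 0
alternatingSum : ℕ → (ℕ → ℚ) → ℚ
alternatingSum q f = cubeSum q (λ c _ → −1^ c · f c)

alternatingSum-suc : ∀ q f → alternatingSum (suc q) f ≡ alternatingSum q (λ c → f c - f (suc c))
alternatingSum-suc q f = trans (sym (cubeSum-+ q (λ c _ → −1^ suc c · f (suc c)) (λ c _ → −1^ c · f c)))
  (cubeSum-cong q (λ c _ _ →
    solve 3 (λ s a b → :- s :* b :+ s :* a := s :* (a :- b)) refl (−1^ c) (f c) (f (suc c))))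

alternatingSum-risingProduct : ∀ b q z → b < q → alternatingSum q (λ c → risingProduct b (z - fromℕ c)) ≡ 0ℚ
alternatingSum-risingProduct zero (suc q) z _ = trans (alternatingSum-suc q _)
  (cubeSum-zero q (λ c _ _ → trans (cong (−1^ c ·_) (ℚₚ.+-inverseʳ 1ℚ)) (ℚₚ.*-zeroʳ (−1^ c))))
alternatingSum-risingProduct (suc b) (suc q) z (s≤s b<q) = begin
  alternatingSum (suc q) (λ c → risingProduct (suc b) (z - fromℕ c))
    ≡⟨ alternatingSum-suc q _ ⟩
  alternatingSum q (λ c → risingProduct (suc b) (z - fromℕ c) - risingProduct (suc b) (z - fromℕ (suc c)))
    ≡⟨ cubeSum-cong q (λ c _ _ → cong (−1^ c ·_) (Δ c)) ⟩
  alternatingSum q (λ c → fromℕ (suc b) · risingProduct b (z - fromℕ c))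
    ≡⟨ cubeSum-cong q (λ c _ _ →
         solve 3 (λ s k r → s :* (k :* r) := k :* (s :* r)) refl (−1^ c) (fromℕ (suc b)) _) ⟩
  cubeSum q (λ c _ → fromℕ (suc b) · (−1^ c · risingProduct b (z - fromℕ c)))
    ≡⟨ cubeSum-· q (fromℕ (suc b)) _ ⟩
  fromℕ (suc b) · alternatingSum q (λ c → risingProduct b (z - fromℕ c))
    ≡⟨ cong (fromℕ (suc b) ·_) (alternatingSum-risingProduct b q z b<q) ⟩
  fromℕ (suc b) · 0ℚ
    ≡⟨ ℚₚ.*-zeroʳ (fromℕ (suc b)) ⟩
  0ℚ  ∎
  where
  open ≡-Reasoning
  Δ : ∀ c → risingProduct (suc b) (z - fromℕ c) - risingProduct (suc b) (z - fromℕ (suc c)) ≡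
            fromℕ (suc b) · risingProduct b (z - fromℕ c)
  Δ c = trans (cong (λ v → risingProduct (suc b) (z - fromℕ c) - risingProduct (suc b) v)
                    (solve 2 (λ z x → z :- (con 1ℚ :+ x) := (z :- x) :- con 1ℚ) refl z (fromℕ c)))
              (risingProduct-Δ b (z - fromℕ c))

-- The semi-symmetric element of V_j

-- A point x ⊇ w is determined by the points of y ∖ w and of ∁ (w ∪ y) that it contains.
∑-supersets : ∀ {n} (w y : Point n) (K : ℕ → ℕ → ℕ → ℚ) →
  ∑ (allPoints n) (λ x → χ (subsetᵇ w x) · K (weight (x ∩ y)) (weight (x ─ y)) (weight (∁ (x ∪ y)))) ≡
  cubeSum (weight (y ─ w)) (λ c _ →
    cubeSum (weight (∁ (w ∪ y))) (λ d d′ → K (c +ₙ weight (w ∩ y)) (d +ₙ weight (w ─ y)) d′))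
∑-supersets [] [] K = trans (ℚₚ.+-identityʳ _) (ℚₚ.*-identityˡ (K 0 0 0))
∑-supersets {suc n} (true ∷ w) (true ∷ y) K =
  trans (∑-allPoints-suc n _)
    (trans (cong₂ _+_ (∑-supersets w y (λ m → K (suc m)))
                      (∑-zero (allPoints n)
                        (λ x → ℚₚ.*-zeroˡ (K (weight (x ∩ y)) (weight (x ─ y)) (weight (∁ (x ∪ y)))))))
      (trans (ℚₚ.+-identityʳ _)
        (cubeSum-cong (weight (y ─ w)) (λ c _ _ → cubeSum-cong (weight (∁ (w ∪ y)))
          (λ d d′ _ → cong (λ m → K m (d +ₙ weight (w ─ y)) d′) (sym (ℕₚ.+-suc c _)))))))
∑-supersets {suc n} (true ∷ w) (false ∷ y) K =
  trans (∑-allPoints-suc n _)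
    (trans (cong₂ _+_ (∑-supersets w y (λ m e → K m (suc e)))
                      (∑-zero (allPoints n)
                        (λ x → ℚₚ.*-zeroˡ (K (weight (x ∩ y)) (weight (x ─ y)) (suc (weight (∁ (x ∪ y))))))))
      (trans (ℚₚ.+-identityʳ _)
        (cubeSum-cong (weight (y ─ w)) (λ c _ _ → cubeSum-cong (weight (∁ (w ∪ y)))
          (λ d d′ _ → cong (λ e → K (c +ₙ weight (w ∩ y)) e d′) (sym (ℕₚ.+-suc d _)))))))
∑-supersets {suc n} (false ∷ w) (true ∷ y) K =
  trans (∑-allPoints-suc n _) (cong₂ _+_ (∑-supersets w y (λ m → K (suc m))) (∑-supersets w y K))
∑-supersets {suc n} (false ∷ w) (false ∷ y) K =
  trans (∑-allPoints-suc n _)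
    (trans (cong₂ _+_ (∑-supersets w y (λ m e → K m (suc e))) (∑-supersets w y (λ m e z → K m e (suc z))))
      (sym (cubeSum-+ (weight (y ─ w)) _ _)))

module _ {n i : ℕ} (y : Point n) where

  -- Up to a constant factor, the sum over all injections π : y → ∁ y of ∏_{t ∈ y} (x_t − x_{π t}).
  canonical : Fun n i
  canonical (x , _) = −1^ weight (x ∩ y) · (factorial (weight (x ─ y)) · factorial (weight (∁ (x ∪ y))))

  canonical≢0 : ∀ x → canonical x ≢ 0ℚ
  canonical≢0 (x , _) = ·-nonzero (−1^≢0 (weight (x ∩ y)))
    (·-nonzero (0<⇒≢0 (factorial-pos (weight (x ─ y)))) (0<⇒≢0 (factorial-pos (weight (∁ (x ∪ y))))))

  canonical-semiSymmetric : SemiSymmetric y canonical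
  canonical-semiSymmetric (x , ∣x∣≡i) (x′ , ∣x′∣≡i) d≡d′ =
    cong₂ _·_ (cong −1^_ m≡m′)
      (cong₂ _·_ (cong factorial (overlap⇒excess y {x} {x′} ∣x∣≡∣x′∣ m≡m′))
                 (cong factorial (overlap⇒outside y {x} {x′} ∣x∣≡∣x′∣ m≡m′)))
    where
    ∣x∣≡∣x′∣ : weight x ≡ weight x′
    ∣x∣≡∣x′∣ = trans ∣x∣≡i (sym ∣x′∣≡i)
    m≡m′ : weight (x ∩ y) ≡ weight (x′ ∩ y)
    m≡m′ = dist⇒overlap y {x} {x′} ∣x∣≡∣x′∣ d≡d′

  module _ {j : ℕ} (∣y∣≡j : weight y ≡ j) (j≤i : j ≤ i) (i+j≤n : i +ₙ j ≤ n)
           (w : Point n) (∣w∣<j : weight w < j) where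

    private
      a b q s : ℕ
      a = weight (w ∩ y)
      b = weight (w ─ y)
      q = weight (y ─ w)
      s = weight (∁ (w ∪ y))

      summand : ℕ → ℕ → ℕ → ℚ
      summand m e z = δ (m +ₙ e) i · (−1^ m · (factorial e · factorial z))

      a+q≡j : a +ₙ q ≡ j
      a+q≡j = trans (∩-─-weightʳ w y) ∣y∣≡j

      b<q : b < q
      b<q = ℕₚ.+-cancelˡ-< a b q (subst₂ _<_ (sym (∩-─-weight w y)) (sym a+q≡j) ∣w∣<j)

      i≤b+s : i ≤ b +ₙ s
      i≤b+s = ℕₚ.+-cancelˡ-≤ j i (b +ₙ s) (begin
        j +ₙ i                   ≡⟨ ℕₚ.+-comm j i ⟩
        i +ₙ j                   ≤⟨ i+j≤n ⟩
        n                        ≡⟨ sym (∁-weight (w ∪ y)) ⟩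
        weight (w ∪ y) +ₙ s      ≡⟨ cong (_+ₙ s) (trans (∪-weight w y) (cong (_+ₙ q) (sym (∩-─-weight w y)))) ⟩
        a +ₙ b +ₙ q +ₙ s         ≡⟨ ℕₚ.+-assoc (a +ₙ b) q s ⟩
        a +ₙ b +ₙ (q +ₙ s)       ≡⟨ interchange a b q s ⟩
        a +ₙ q +ₙ (b +ₙ s)       ≡⟨ cong (_+ₙ (b +ₙ s)) a+q≡j ⟩
        j +ₙ (b +ₙ s)            ∎)
        where open ℕₚ.≤-Reasoning

      z₀ : ℚ
      z₀ = fromℕ i - (fromℕ a + fromℕ b)

      -- the points x ⊇ w that contain exactly c points of y ∖ w
      fibre : ∀ c → c ≤ q → cubeSum s (λ d d′ → summand (c +ₙ a) (d +ₙ b) d′) ≡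
                              (−1^ a · factorial s) · (−1^ c · risingProduct b (z₀ - fromℕ c))
      fibre c c≤q = begin
        cubeSum s (λ d d′ → summand (c +ₙ a) (d +ₙ b) d′)
          ≡⟨ cubeSum-cong s (λ d d′ _ →
               cong (λ l → δ l i · (−1^ (c +ₙ a) · (factorial (d +ₙ b) · factorial d′))) (rearrange d)) ⟩
        cubeSum s (λ d d′ → δ (d +ₙ k) i · (−1^ (c +ₙ a) · (factorial (d +ₙ b) · factorial d′)))
          ≡⟨ cubeSum-cong s (λ d d′ _ →
               solve 3 (λ δ σ f → δ :* (σ :* f) := σ :* (δ :* f)) refl (δ (d +ₙ k) i) (−1^ (c +ₙ a)) _) ⟩
        cubeSum s (λ d d′ → −1^ (c +ₙ a) · (δ (d +ₙ k) i · (factorial (d +ₙ b) · factorial d′)))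
          ≡⟨ cubeSum-· s (−1^ (c +ₙ a)) _ ⟩
        −1^ (c +ₙ a) · cubeSum s (λ d d′ → δ (d +ₙ k) i · (factorial (d +ₙ b) · factorial d′))
          ≡⟨ cong₂ _·_ (−1^-+ c a) (cubeSum-δ b s k i i≤k+s k≤i+b) ⟩
        −1^ c · −1^ a · (factorial s · risingProduct b (fromℕ i - fromℕ k))
          ≡⟨ cong (λ v → −1^ c · −1^ a · (factorial s · risingProduct b v)) i-k≡z₀-c ⟩
        −1^ c · −1^ a · (factorial s · risingProduct b (z₀ - fromℕ c))
          ≡⟨ solve 4 (λ σ τ f r → σ :* τ :* (f :* r) := τ :* f :* (σ :* r)) refl (−1^ c) (−1^ a) (factorial s) _ ⟩
        (−1^ a · factorial s) · (−1^ c · risingProduct b (z₀ - fromℕ c))  ∎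
        where
        open ≡-Reasoning
        k : ℕ
        k = c +ₙ a +ₙ b
        rearrange : ∀ d → c +ₙ a +ₙ (d +ₙ b) ≡ d +ₙ k
        rearrange d = trans (sym (ℕₚ.+-assoc (c +ₙ a) d b))
          (trans (cong (_+ₙ b) (ℕₚ.+-comm (c +ₙ a) d)) (ℕₚ.+-assoc d (c +ₙ a) b))
        i≤k+s : i ≤ k +ₙ s
        i≤k+s = ℕₚ.≤-trans i≤b+s (ℕₚ.+-monoˡ-≤ s (ℕₚ.m≤n+m b (c +ₙ a)))
        k≤i+b : k ≤ i +ₙ b
        k≤i+b = ℕₚ.+-monoˡ-≤ b
          (ℕₚ.≤-trans (subst (c +ₙ a ≤_) (trans (ℕₚ.+-comm q a) a+q≡j) (ℕₚ.+-monoˡ-≤ a c≤q)) j≤i)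
        i-k≡z₀-c : fromℕ i - fromℕ k ≡ z₀ - fromℕ c
        i-k≡z₀-c = trans (cong (λ v → fromℕ i - v) (trans (fromℕ-+ (c +ₙ a) b) (cong (_+ fromℕ b) (fromℕ-+ c a))))
          (solve 4 (λ I C A B → I :- ((C :+ A) :+ B) := (I :- (A :+ B)) :- C) refl
                   (fromℕ i) (fromℕ c) (fromℕ a) (fromℕ b))

    canonical-⊥gz : ⟪ canonical , gz w ⟫ ≡ 0ℚ
    canonical-⊥gz = begin
      ⟪ canonical , gz w ⟫
        ≡⟨ ⟪⟫-as-∑ canonical (gz w) (λ x → χ (subsetᵇ w x) · F x) (λ x → ℚₚ.*-comm (canonical x) (gz w x)) ⟩
      ∑ (allPoints n) (λ x → δ (weight x) i · (χ (subsetᵇ w x) · F x))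
        ≡⟨ ∑-cong (allPoints n) (λ x → trans (cong (λ l → δ l i · (χ (subsetᵇ w x) · F x)) (sym (∩-─-weight x y)))
             (solve 3 (λ δ χ f → δ :* (χ :* f) := χ :* (δ :* f)) refl
                      (δ (weight (x ∩ y) +ₙ weight (x ─ y)) i) (χ (subsetᵇ w x)) (F x))) ⟩
      ∑ (allPoints n) (λ x → χ (subsetᵇ w x) · summand (weight (x ∩ y)) (weight (x ─ y)) (weight (∁ (x ∪ y))))
        ≡⟨ ∑-supersets w y summand ⟩
      cubeSum q (λ c _ → cubeSum s (λ d d′ → summand (c +ₙ a) (d +ₙ b) d′))
        ≡⟨ cubeSum-cong q (λ c c′ c+c′≡q → fibre c (subst (c ≤_) c+c′≡q (ℕₚ.m≤m+n c c′))) ⟩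
      cubeSum q (λ c _ → (−1^ a · factorial s) · (−1^ c · risingProduct b (z₀ - fromℕ c)))
        ≡⟨ cubeSum-· q (−1^ a · factorial s) _ ⟩
      (−1^ a · factorial s) · alternatingSum q (λ c → risingProduct b (z₀ - fromℕ c))
        ≡⟨ cong ((−1^ a · factorial s) ·_) (alternatingSum-risingProduct b q z₀ b<q) ⟩
      (−1^ a · factorial s) · 0ℚ
        ≡⟨ ℚₚ.*-zeroʳ (−1^ a · factorial s) ⟩
      0ℚ  ∎
      where
      open ≡-Reasoning
      F : Point n → ℚ
      F x = −1^ weight (x ∩ y) · (factorial (weight (x ─ y)) · factorial (weight (∁ (x ∪ y))))

  canonical-⊥U< : ∀ {j} → weight y ≡ j → j ≤ i → i +ₙ j ≤ n → ⊥U< j canonical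
  canonical-⊥U< ∣y∣≡j j≤i i+j≤n = canonical-⊥gz ∣y∣≡j j≤i i+j≤n

-- Spanning

module _ {n i : ℕ} where

  _+ˢ_ : (Fun n i → Set) → (Fun n i → Set) → Fun n i → Set
  (A +ˢ B) f = Σ (Fun n i) λ g → A g × B (f -ᶠ g)

  +ˢ-isSubspace : ∀ {A B} → IsSubspace A → IsSubspace B → IsSubspace (A +ˢ B)
  +ˢ-isSubspace {A} {B} subA subB = record
    { resp-≗ = λ f≗f′ (g , g∈A , f-g∈B) → g , g∈A , resp-≗ subB (λ x → cong (_- g x) (f≗f′ x)) f-g∈B
    ; 0ᶠ-closed = 0ᶠ , 0ᶠ-closed subA , resp-≗ subB (λ _ → sym (ℚₚ.+-inverseʳ 0ℚ)) (0ᶠ-closed subB)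
    ; +ᶠ-closed = λ {f₁} {f₂} (g₁ , g₁∈A , f₁-g₁∈B) (g₂ , g₂∈A , f₂-g₂∈B) →
        g₁ +ᶠ g₂ , +ᶠ-closed subA g₁∈A g₂∈A ,
        resp-≗ subB (λ x → solve 4 (λ a b c d → (a :- b) :+ (c :- d) := (a :+ c) :- (b :+ d)) refl
                                    (f₁ x) (g₁ x) (f₂ x) (g₂ x))
          (+ᶠ-closed subB f₁-g₁∈B f₂-g₂∈B)
    ; ·ᶠ-closed = λ c {f} (g , g∈A , f-g∈B) →
        c ·ᶠ g , ·ᶠ-closed subA c g∈A ,
        resp-≗ subB (λ x → solve 3 (λ c a b → c :* (a :- b) := c :* a :- c :* b) refl c (f x) (g x))
                    (·ᶠ-closed subB c f-g∈B)
    }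

module _ {n i j : ℕ} (j≤i : j ≤ i) (i+j≤n : i +ₙ j ≤ n) where

  canonical∈V : ∀ y → weight y ≡ j → V j (canonical {n} {i} y)
  canonical∈V y ∣y∣≡j = U∩⊥U<⇒V j (semiSymmetric⇒U y ∣y∣≡j j≤i i+j≤n (canonical-semiSymmetric y))
                                   (canonical-⊥U< y ∣y∣≡j j≤i i+j≤n)

  V-semiSymmetric-unique : ∀ y → weight y ≡ j → ∀ {G} → V j G → SemiSymmetric y G →
                           Σ ℚ λ c → ∀ x → G x ≡ c · canonical y x
  V-semiSymmetric-unique y ∣y∣≡j {G} G∈V G-ss = c , λ x → x-y≡0⇒x≡y (H≗0 x)
    where
    x₀ : S n i
    x₀ = proj₁ (pointWithOverlap y ∣y∣≡j j≤i i+j≤n ℕₚ.≤-refl)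
    instance
      F[x₀]-nonZero : ℚ.NonZero (canonical y x₀)
      F[x₀]-nonZero = ℚ.≢-nonZero (canonical≢0 y x₀)
    c : ℚ
    c = G x₀ · 1/ canonical y x₀
    H : Fun n i
    H = G -ᶠ c ·ᶠ canonical y
    H-ss : SemiSymmetric y H
    H-ss x x′ d≡d′ = cong₂ (λ g f → g - c · f) (G-ss x x′ d≡d′) (canonical-semiSymmetric y x x′ d≡d′)
    H⊥U< : ⊥U< j H
    H⊥U< = -ᶠ-closed (⊥U<-isSubspace j) (V⇒⊥U< j G∈V)
                     (·ᶠ-closed (⊥U<-isSubspace j) c (canonical-⊥U< y ∣y∣≡j j≤i i+j≤n))
    H[x₀]≡0 : H x₀ ≡ 0ℚ
    H[x₀]≡0 = begin
      G x₀ - G x₀ · 1/ canonical y x₀ · canonical y x₀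
        ≡⟨ cong (λ v → G x₀ - v)
                (trans (ℚₚ.*-assoc (G x₀) _ _) (cong (G x₀ ·_) (ℚₚ.*-inverseˡ (canonical y x₀)))) ⟩
      G x₀ - G x₀ · 1ℚ
        ≡⟨ cong (λ v → G x₀ - v) (ℚₚ.*-identityʳ (G x₀)) ⟩
      G x₀ - G x₀
        ≡⟨ ℚₚ.+-inverseʳ (G x₀) ⟩
      0ℚ  ∎
      where open ≡-Reasoning
    H≗0 : H ≗ 0ᶠ
    H≗0 = semiSymmetric-⊥U<-vanishes y ∣y∣≡j H-ss H⊥U< x₀
            (proj₂ (pointWithOverlap y ∣y∣≡j j≤i i+j≤n ℕₚ.≤-refl)) H[x₀]≡0

  module _ (F : Point n → Fun n i)
           (F-spec : ∀ y → weight y ≡ j → NonZero (F y) × V j (F y) × SemiSymmetric y (F y)) where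

    private
      SpanF : Fun n i → Set
      SpanF = InSpan (λ y → weight y ≡ j) F

    span⊆V : ∀ {f} → SpanF f → V j f
    span⊆V = span-least _ F (V-isSubspace j) (λ {y} ∣y∣≡j → proj₁ (proj₂ (F-spec y ∣y∣≡j)))

    gz∈F+U< : ∀ y → weight y ≡ j → Σ ℚ λ κ → U< j (gz y -ᶠ κ ·ᶠ F y)
    gz∈F+U< y ∣y∣≡j =
      1/ D , resp-≗ (U<-isSubspace j) rescale (·ᶠ-closed (U<-isSubspace j) (- 1/ D) Fy-Dgy∈U<)
      where
      Fy-spec : NonZero (F y) × V j (F y) × SemiSymmetric y (F y)
      Fy-spec = F-spec y ∣y∣≡j
      decomposition : Σ ℚ λ D → U< j (F y -ᶠ D ·ᶠ gz y)
      decomposition = semiSymmetric-decomposition y ∣y∣≡j j≤i i+j≤n (proj₂ (proj₂ Fy-spec))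
      D : ℚ
      D = proj₁ decomposition
      Fy-Dgy∈U< : U< j (F y -ᶠ D ·ᶠ gz y)
      Fy-Dgy∈U< = proj₂ decomposition
      D≢0 : D ≢ 0ℚ
      D≢0 D≡0 = proj₂ (proj₁ Fy-spec)
        (U<∩⊥U<⇒≗0 j Fy∈U< (V⇒⊥U< j (proj₁ (proj₂ Fy-spec))) (proj₁ (proj₁ Fy-spec)))
        where
        Fy∈U< : U< j (F y)
        Fy∈U< = resp-≗ (U<-isSubspace j)
          (λ x → trans (cong (λ d → F y x - d · gz y x) D≡0)
                       (solve 2 (λ f g → f :- con 0ℚ :* g := f) refl (F y x) (gz y x)))
          Fy-Dgy∈U<
      instance
        D-nonZero : ℚ.NonZero D
        D-nonZero = ℚ.≢-nonZero D≢0
      rescale : (- 1/ D) ·ᶠ (F y -ᶠ D ·ᶠ gz y) ≗ gz y -ᶠ 1/ D ·ᶠ F y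
      rescale x = begin
        - 1/ D · (F y x - D · gz y x)
          ≡⟨ solve 4 (λ k f d g → (:- k) :* (f :- d :* g) := (k :* d) :* g :- k :* f) refl (1/ D) (F y x) D (gz y x) ⟩
        1/ D · D · gz y x - 1/ D · F y x
          ≡⟨ cong (λ u → u · gz y x - 1/ D · F y x) (ℚₚ.*-inverseˡ D) ⟩
        1ℚ · gz y x - 1/ D · F y x
          ≡⟨ cong (_- 1/ D · F y x) (ℚₚ.*-identityˡ (gz y x)) ⟩
        gz y x - 1/ D · F y x  ∎
        where open ≡-Reasoning

    U⊆span+U< : ∀ {f} → U j f → (SpanF +ˢ U< j) f
    U⊆span+U< = span-least _ gz (+ˢ-isSubspace (span-isSubspace _ F) (U<-isSubspace j))
                                (λ {z} → gz∈span+U< z)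
      where
      gz∈span+U< : ∀ z → weight z ≤ j → (SpanF +ˢ U< j) (gz z)
      gz∈span+U< z ∣z∣≤j with ℕₚ.m≤n⇒m<n∨m≡n ∣z∣≤j
      ... | inj₁ ∣z∣<j = 0ᶠ , 0ᶠ-closed (span-isSubspace _ F) ,
                         resp-≗ (U<-isSubspace j) (λ x → sym (ℚₚ.+-identityʳ (gz z x))) (span-gen _ gz z ∣z∣<j)
      ... | inj₂ ∣z∣≡j = κ ·ᶠ F z , ·ᶠ-closed (span-isSubspace _ F) κ (span-gen _ F z ∣z∣≡j) , gz-κF∈U<
        where
        κ : ℚ
        κ = proj₁ (gz∈F+U< z ∣z∣≡j)
        gz-κF∈U< : U< j (gz z -ᶠ κ ·ᶠ F z)
        gz-κF∈U< = proj₂ (gz∈F+U< z ∣z∣≡j)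

    V⊆span : ∀ {f} → V j f → SpanF f
    V⊆span {f} f∈V = resp-≗ (span-isSubspace _ F) g≗f g∈span
      where
      split : (SpanF +ˢ U< j) f
      split = U⊆span+U< (V⇒U j f∈V)
      g : Fun n i
      g = proj₁ split
      g∈span : SpanF g
      g∈span = proj₁ (proj₂ split)
      f-g≗0 : f -ᶠ g ≗ 0ᶠ
      f-g≗0 = U<∩⊥U<⇒≗0 j (proj₂ (proj₂ split))
                (-ᶠ-closed (⊥U<-isSubspace j) (V⇒⊥U< j f∈V) (V⇒⊥U< j (span⊆V g∈span)))
      g≗f : g ≗ f
      g≗f x = sym (x-y≡0⇒x≡y {f x} {g x} (f-g≗0 x))

proposition1p6 : (n i j : ℕ) → j ≤ i → 2 * i ≤ n →
    ((y : Point n) → weight y ≡ j →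
      Σ (Fun n i) λ F → NonZero F × V j F × SemiSymmetric y F ×
        ((G : Fun n i) → V j G → SemiSymmetric y G →
          Σ ℚ λ c → (x : S n i) → G x ≡ c *ℚ F x))
    ×
    ((F : Point n → Fun n i) →
      ((y : Point n) → weight y ≡ j → NonZero (F y) × V j (F y) × SemiSymmetric y (F y)) →
      ((f : Fun n i) → V j f → InSpan (λ y → weight y ≡ j) F f)
      × ((f : Fun n i) → InSpan (λ y → weight y ≡ j) F f → V j f))
proposition1p6 n i j j≤i 2i≤n =
  (λ y ∣y∣≡j → canonical y , (x₀ y ∣y∣≡j , canonical≢0 y (x₀ y ∣y∣≡j)) , canonical∈V j≤i i+j≤n y ∣y∣≡j ,
               canonical-semiSymmetric y , λ G G∈V G-ss → V-semiSymmetric-unique j≤i i+j≤n y ∣y∣≡j G∈V G-ss) ,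
  (λ F F-spec → (λ f → V⊆span j≤i i+j≤n F F-spec) , (λ f → span⊆V j≤i i+j≤n F F-spec))
  where
  i+j≤n : i +ₙ j ≤ n
  i+j≤n = ℕₚ.≤-trans (ℕₚ.+-monoʳ-≤ i j≤i) (subst (λ m → i +ₙ m ≤ n) (ℕₚ.+-identityʳ i) 2i≤n)
  x₀ : ∀ y → weight y ≡ j → S n i
  x₀ y ∣y∣≡j = proj₁ (pointWithOverlap y ∣y∣≡j j≤i i+j≤n ℕₚ.≤-refl)
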